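{- Let $n\ge1$. Number the $2n+1$ external nodes of a ternary tree with $n$ internal nodes by $0,1,\dots,2n$ from left to right (inorder traversal). For $m_1,m_2,m_3\ge0$ let $T_{n,s,m_1,m_2,m_3}$ be the number of ternary trees of size $n$ in which the path from the root to external node $s$ consists of $m_1$ left edges, $m_2$ center edges and $m_3$ right edges. Write $s=2s_1+s_2$ with $0\le s_1\le n$, $s_2\in\{0,1\}$. Then: (i) if $0\le m_3\le s_1$, $m_2=s_2+2\mu_2$ with $0\le\mu_2\le s_1-m_3$, and $(m_1,m_2)\ne(0,0)$, $(m_3,m_2)\ne(0,0)$, $$T_{n,s,m_1,m_2,m_3}=\frac{(2m_3+m_2)(2m_1+m_2)\binom{m_1+m_2+m_3}{m_1,m_2,m_3}\binom{3s_1+s_2-m_3-\mu_2}{s_1-m_3-\mu_2}\binom{3n-m_1-2m_2-3s_1+3\mu_2}{n-m_1-m_2-s_1+\mu_2}}{(3s_1+s_2-m_3-\mu_2)(3n-m_1-2m_2-3s_1+3\mu_2)};$$ (ii) if $(m_2,m_3)=(0,0)$, $s=0$ and $0\le m_1\le n$, then $T_{n,s,m_1,m_2,m_3}=\frac{2m_1}{3n-m_1}\binom{3n-m_1}{2n}$; (iii) if $(m_1,m_2)=(0,0)$, $s=2n$ and $0\le m_3\le n$, then $T_{n,s,m_1,m_2,m_3}=\frac{2m_3}{3n-m_3}\binom{3n-m_3}{2n}$; (iv) in all other cases $T_{n,s,m_1,m_2,m_3}=0$.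
   Context: A ternary tree is either an external node or an internal node with three ordered subtrees (left, center, right); size = number of internal nodes, so a tree of size $n$ has $2n+1$ external nodes. Inorder traversal: starting at the root, recursively traverse the left, then the center, then the right subtree; external nodes are numbered $0,1,2,\dots$ in the order visited. An edge from a node to its left (center, right) child is called a left (center, right) edge (types $e_1,e_2,e_3$). -}

module Defs where

open import Data.Nat using (ℕ; zero; suc; _+_; _*_; _≡ᵇ_)
open import Data.Nat.Combinatorics using (_C_)
open import Data.Bool using (Bool; _∧_; false; true)
open import Data.List using (List; []; _∷_; [_]; _++_; map; concatMap; filterᵇ; length)
open import Data.Maybe using (Maybe; just; nothing)
open import Data.Integer as ℤ using (ℤ; +_; -[1+_])

data Edge : Set where
  e₁ e₂ e₃ : Edge

data Tree : Set where
  ext : Tree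
  int : Tree → Tree → Tree → Tree

size : Tree → ℕ
size ext         = 0
size (int l c r) = suc (size l + size c + size r)

-- Paths (as edge-type sequences) from the root to the external nodes,
-- listed in inorder (external node 0 first, then 1, 2, ...)
extPaths : Tree → List (List Edge)
extPaths ext         = [ [] ]
extPaths (int l c r) =
  map (e₁ ∷_) (extPaths l) ++ map (e₂ ∷_) (extPaths c) ++ map (e₃ ∷_) (extPaths r)

nth : {A : Set} → List A → ℕ → Maybe A
nth []       _       = nothing
nth (x ∷ xs) zero    = just x
nth (x ∷ xs) (suc i) = nth xs i

pathTo : Tree → ℕ → Maybe (List Edge)
pathTo t s = nth (extPaths t) s

isE₁ isE₂ isE₃ : Edge → Bool
isE₁ e₁ = true
isE₁ _  = false
isE₂ e₂ = true
isE₂ _  = false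
isE₃ e₃ = true
isE₃ _  = false

countE : (Edge → Bool) → List Edge → ℕ
countE p es = length (filterᵇ p es)

-- all ternary trees of height ≤ d (each exactly once)
treesOfHeight≤ : ℕ → List Tree
treesOfHeight≤ zero    = [ ext ]
treesOfHeight≤ (suc d) =
  ext ∷ concatMap (λ l → concatMap (λ c → map (int l c) ts) ts) ts
  where ts = treesOfHeight≤ d

-- all ternary trees of size n (a tree of size n has height ≤ n)
trees : ℕ → List Tree
trees n = filterᵇ (λ t → size t ≡ᵇ n) (treesOfHeight≤ n)

pathHas : ℕ → ℕ → ℕ → ℕ → Tree → Bool
pathHas s m₁ m₂ m₃ t with pathTo t s
... | nothing = false
... | just p  = (countE isE₁ p ≡ᵇ m₁) ∧ (countE isE₂ p ≡ᵇ m₂) ∧ (countE isE₃ p ≡ᵇ m₃)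

Tcount : ℕ → ℕ → ℕ → ℕ → ℕ → ℕ
Tcount n s m₁ m₂ m₃ = length (filterᵇ (pathHas s m₁ m₂ m₃) (trees n))

-- trinomial coefficient (a+b+c)! / (a! b! c!)
multinomial3 : ℕ → ℕ → ℕ → ℕ
multinomial3 a b c = ((a + b + c) C a) * ((b + c) C b)

-- binomial coefficient with integer arguments: 0 if the lower index is negative
-- (or upper index negative, which never occurs with nonnegative lower index here)
binomℤ : ℤ → ℤ → ℕ
binomℤ (+ a) (+ b) = a C b
binomℤ _     _     = 0

open import Data.Nat using (_≤_; _∸_)
open import Data.Product using (_×_; Σ)
open import Relation.Binary.PropositionalEquality using (_≡_)
open import Relation.Nullary using (¬_)

CaseI : (s₁ s₂ m₁ m₂ m₃ μ₂ : ℕ) → Set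
CaseI s₁ s₂ m₁ m₂ m₃ μ₂ =
  m₃ ≤ s₁ × m₂ ≡ s₂ + 2 * μ₂ × μ₂ ≤ s₁ ∸ m₃
  × ¬ (m₁ ≡ 0 × m₂ ≡ 0) × ¬ (m₃ ≡ 0 × m₂ ≡ 0)

CaseII : (n s m₁ m₂ m₃ : ℕ) → Set
CaseII n s m₁ m₂ m₃ = m₂ ≡ 0 × m₃ ≡ 0 × s ≡ 0 × m₁ ≤ n

CaseIII : (n s m₁ m₂ m₃ : ℕ) → Set
CaseIII n s m₁ m₂ m₃ = m₁ ≡ 0 × m₂ ≡ 0 × s ≡ 2 * n × m₃ ≤ n

D₁ D₂ bot₁ bot₂ : (n s₁ s₂ m₁ m₂ m₃ μ₂ : ℕ) → ℤ
D₁   n s₁ s₂ m₁ m₂ m₃ μ₂ = + (3 * s₁ + s₂) ℤ.- + (m₃ + μ₂)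
bot₁ n s₁ s₂ m₁ m₂ m₃ μ₂ = + s₁ ℤ.- + (m₃ + μ₂)
D₂   n s₁ s₂ m₁ m₂ m₃ μ₂ = + (3 * n + 3 * μ₂) ℤ.- + (m₁ + 2 * m₂ + 3 * s₁)
bot₂ n s₁ s₂ m₁ m₂ m₃ μ₂ = + (n + μ₂) ℤ.- + (m₁ + m₂ + s₁)

NumI : (n s₁ s₂ m₁ m₂ m₃ μ₂ : ℕ) → ℕ
NumI n s₁ s₂ m₁ m₂ m₃ μ₂ =
  (2 * m₃ + m₂) * (2 * m₁ + m₂) * multinomial3 m₁ m₂ m₃
  * binomℤ (D₁ n s₁ s₂ m₁ m₂ m₃ μ₂) (bot₁ n s₁ s₂ m₁ m₂ m₃ μ₂)
  * binomℤ (D₂ n s₁ s₂ m₁ m₂ m₃ μ₂) (bot₂ n s₁ s₂ m₁ m₂ m₃ μ₂)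

-- Cut a tree along the path from its root to external node s. Every left edge of the path leaves
-- two sibling subtrees to the right of the path, every center edge one on each side and every right
-- edge two on the left. So a tree counted by T is the same thing as an arrangement of the m₁, m₂,
-- m₃ edges along the path (a trinomial coefficient) together with two ordered forests: kL = m₂ + 2m₃
-- trees left of the path with a internal nodes and kR = 2m₁ + m₂ trees right of it with b internal
-- nodes, where m₁ + m₂ + m₃ + a + b = n and s = 2a + kL. A forest of k ternary trees with a internal
-- nodes is counted by k/(3a + k) · C(3a + k, a), by induction on the first tree. The cases of the
-- theorem sort out when such a and b exist (s and m₂ must have compatible parities) and when an
-- empty forest (kL = 0 or kR = 0) is forced to carry internal nodes.

module Submission where

open import Data.Bool using (Bool; true; false; _∧_)
open import Data.List using (List; []; _∷_; _++_; map; concatMap; filterᵇ; length)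
open import Data.List.Properties using (length-map; length-++)
open import Data.Maybe using (just; nothing; maybe′)
open import Data.Nat
open import Data.Nat.Combinatorics using (_C_; nCk+nC[k+1]≡[n+1]C[k+1]; nCn≡1; nC1≡n; nCk≡nC[n∸k])
open import Data.Nat.DivMod using (_/_; _%_; m≡m%n+[m/n]*n; m%n<n)
open import Data.Nat.Properties
open import Data.Nat.Tactic.RingSolver using (solve-∀)
open import Data.Product using (_×_; _,_; ∃; proj₁; proj₂)
open import Data.Sum using (_⊎_; inj₁; inj₂)
open import Function using (_∘_)
open import Relation.Binary.PropositionalEquality
open import Relation.Nullary using (¬_; yes; no; contradiction)
open import Relation.Binary.Definitions using (tri<; tri≈; tri>)

open import Defs

-- Binomial and trinomial coefficients

binom : ℕ → ℕ → ℕ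
binom n       zero    = 1
binom zero    (suc k) = 0
binom (suc n) (suc k) = binom n k + binom n (suc k)

binom≡C : ∀ n k → binom n k ≡ n C k
binom≡C n       zero    = refl
binom≡C zero    (suc k) = refl
binom≡C (suc n) (suc k) =
  trans (cong₂ _+_ (binom≡C n k) (binom≡C n (suc k))) (nCk+nC[k+1]≡[n+1]C[k+1] n k)

binom-n-1 : ∀ n → binom n 1 ≡ n
binom-n-1 n = trans (binom≡C n 1) (nC1≡n n)

binom-n-n : ∀ n → binom n n ≡ 1
binom-n-n n = trans (binom≡C n n) (nCn≡1 n)

binom-absorption : ∀ n k → suc k * binom n (suc k) + k * binom n k ≡ n * binom n k
binom-absorption zero    zero    = refl
binom-absorption zero    (suc k) = cong₂ _+_ (*-zeroʳ (suc (suc k))) (*-zeroʳ (suc k))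
binom-absorption (suc n) zero    rewrite binom-n-1 n = lemma n
  where lemma : ∀ n → 1 * suc n + 0 * 1 ≡ suc n * 1
        lemma = solve-∀
binom-absorption (suc n) (suc k) = begin
  suc (suc k) * (Y + Z) + suc k * (X + Y)
    ≡⟨ regroup k X Y Z ⟩
  (suc (suc k) * Z + suc k * Y) + (suc k * Y + k * X) + (X + Y)
    ≡⟨ cong₂ (λ a b → a + b + (X + Y)) (binom-absorption n (suc k)) (binom-absorption n k) ⟩
  n * Y + n * X + (X + Y)
    ≡⟨ collect n X Y ⟩
  suc n * (X + Y) ∎
  where
  open ≡-Reasoning
  X = binom n k
  Y = binom n (suc k)
  Z = binom n (suc (suc k))
  regroup : ∀ k X Y Z → suc (suc k) * (Y + Z) + suc k * (X + Y)
                      ≡ (suc (suc k) * Z + suc k * Y) + (suc k * Y + k * X) + (X + Y)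
  regroup = solve-∀
  collect : ∀ n X Y → n * Y + n * X + (X + Y) ≡ suc n * (X + Y)
  collect = solve-∀

atPred : ℕ → (ℕ → ℕ) → ℕ
atPred zero    f = 0
atPred (suc m) f = f m

atPred-cong : ∀ m {f g : ℕ → ℕ} → (∀ x → f x ≡ g x) → atPred m f ≡ atPred m g
atPred-cong zero    _ = refl
atPred-cong (suc m) h = h m

atPred-*ʳ : ∀ m (f : ℕ → ℕ) k → atPred m f * k ≡ atPred m (λ x → f x * k)
atPred-*ʳ zero    f k = refl
atPred-*ʳ (suc m) f k = refl

binom₂ : ℕ → ℕ → ℕ
binom₂ b c = binom (b + c) b

binom₂-b-0 : ∀ b → binom₂ b 0 ≡ 1
binom₂-b-0 b = trans (cong (λ m → binom m b) (+-identityʳ b)) (binom-n-n b)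

binom₂-pascal : ∀ b c → 1 ≤ b + c → binom₂ b c ≡ atPred b (λ x → binom₂ x c) + atPred c (binom₂ b)
binom₂-pascal zero    (suc c) _ = refl
binom₂-pascal (suc b) zero    _ = trans (binom₂-b-0 (suc b)) (sym (trans (+-identityʳ _) (binom₂-b-0 b)))
binom₂-pascal (suc b) (suc c) _ = cong (λ x → binom (b + suc c) b + x) (cong (λ m → binom m (suc b)) (+-suc b c))

trinom : ℕ → ℕ → ℕ → ℕ
trinom a b c = binom₂ a (b + c) * binom₂ b c

trinom≡multinomial3 : ∀ a b c → trinom a b c ≡ multinomial3 a b c
trinom≡multinomial3 a b c =
  cong₂ _*_ (trans (cong (λ m → binom m a) (sym (+-assoc a b c))) (binom≡C _ a)) (binom≡C (b + c) b)

atPred-b+c-pascal : ∀ a b c → 1 ≤ b + c →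
  atPred (b + c) (binom₂ a) * binom₂ b c
    ≡ atPred b (λ x → binom₂ a (x + c) * binom₂ x c) + atPred c (λ x → binom₂ a (b + x) * binom₂ b x)
atPred-b+c-pascal a zero    (suc c) _ = refl
atPred-b+c-pascal a (suc b) zero    _ =
  trans (cong (binom₂ a (b + 0) *_) (trans (binom₂-b-0 (suc b)) (sym (binom₂-b-0 b)))) (sym (+-identityʳ _))
atPred-b+c-pascal a (suc b) (suc c) _ =
  trans (cong (binom₂ a (b + suc c) *_) (binom₂-pascal (suc b) (suc c) (s≤s z≤n)))
  (trans (*-distribˡ-+ (binom₂ a (b + suc c)) (binom₂ b (suc c)) (binom₂ (suc b) c))
         (cong (λ m → binom₂ a (b + suc c) * binom₂ b (suc c) + binom₂ a m * binom₂ (suc b) c) (+-suc b c)))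

trinom-pascal⁺ : ∀ a b c → 1 ≤ b + c →
  trinom a b c ≡ atPred a (λ x → trinom x b c) + atPred b (λ x → trinom a x c) + atPred c (trinom a b)
trinom-pascal⁺ a b c h =
  trans (cong (_* binom₂ b c) (binom₂-pascal a (b + c) (≤-trans h (m≤n+m (b + c) a))))
  (trans (*-distribʳ-+ (binom₂ b c) (atPred a (λ x → binom₂ x (b + c))) (atPred (b + c) (binom₂ a)))
  (trans (cong₂ _+_ (atPred-*ʳ a (λ x → binom₂ x (b + c)) (binom₂ b c)) (atPred-b+c-pascal a b c h))
  (sym (+-assoc (atPred a (λ x → trinom x b c)) _ _))))

trinom-pascal : ∀ a b c → 1 ≤ a + b + c →
  trinom a b c ≡ atPred a (λ x → trinom x b c) + atPred b (λ x → trinom a x c) + atPred c (trinom a b)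
trinom-pascal (suc a) zero    zero    _ =
  trans (trans (*-identityʳ _) (binom₂-b-0 (suc a)))
        (sym (trans (+-identityʳ _) (trans (+-identityʳ _) (trans (*-identityʳ _) (binom₂-b-0 a)))))
trinom-pascal a       (suc b) c       _ = trinom-pascal⁺ a (suc b) c (s≤s z≤n)
trinom-pascal a       zero    (suc c) _ = trinom-pascal⁺ a zero (suc c) (s≤s z≤n)

-- Forests and the ballot formula

-- forests k a counts sequences of k ternary trees with a internal nodes in total:
-- the first tree is either external, or is replaced by its three subtrees.
forests : ℕ → ℕ → ℕ
forests zero    zero    = 1
forests zero    (suc a) = 0
forests (suc k) zero    = forests k zero
forests (suc k) (suc a) = forests k (suc a) + forests (3 + k) a

forests-k-0 : ∀ k → forests k 0 ≡ 1
forests-k-0 zero    = refl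
forests-k-0 (suc k) = forests-k-0 k

forests-0-≢0 : ∀ a → a ≢ 0 → forests 0 a ≡ 0
forests-0-≢0 zero    a≢0 = contradiction refl a≢0
forests-0-≢0 (suc a) _   = refl

ballot-step : ∀ k a F₁ F₂ X Y → let M = 3 * a + k + 3 in
  M * F₁ ≡ k * Y → M * F₂ ≡ (k + 3) * X → suc a * Y + a * X ≡ M * X →
  suc M * (F₁ + F₂) ≡ suc k * (X + Y)
ballot-step k a F₁ F₂ X Y hF₁ hF₂ hXY = *-cancelˡ-≡ _ _ (3 * a + k + 3) {{M-nonZero}} (begin
  M * (suc M * (F₁ + F₂))           ≡⟨ distribute k a F₁ F₂ ⟩
  suc M * (M * F₁ + M * F₂)         ≡⟨ cong₂ (λ u v → suc M * (u + v)) hF₁ hF₂ ⟩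
  suc M * (k * Y + (k + 3) * X)     ≡⟨ +-cancelʳ-≡ (3 * (suc a * Y)) _ _ (trans (rearrange k a X Y)
                                         (cong (λ z → M * (suc k * (X + Y)) + 3 * z) (sym hY))) ⟩
  M * (suc k * (X + Y))             ∎)
  where
  open ≡-Reasoning
  M = 3 * a + k + 3
  M-nonZero : NonZero M
  M-nonZero = >-nonZero (≤-<-trans z≤n (m<m+n (3 * a + k) z<s))
  split : ∀ a k X → (3 * a + k + 3) * X ≡ (2 * a + k + 3) * X + a * X
  split = solve-∀
  hY : suc a * Y ≡ (2 * a + k + 3) * X
  hY = +-cancelʳ-≡ (a * X) _ _ (trans hXY (split a k X))
  distribute : ∀ k a F₁ F₂ → (3 * a + k + 3) * (suc (3 * a + k + 3) * (F₁ + F₂))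
             ≡ suc (3 * a + k + 3) * ((3 * a + k + 3) * F₁ + (3 * a + k + 3) * F₂)
  distribute = solve-∀
  rearrange : ∀ k a X Y → suc (3 * a + k + 3) * (k * Y + (k + 3) * X) + 3 * (suc a * Y)
            ≡ (3 * a + k + 3) * (suc k * (X + Y)) + 3 * ((2 * a + k + 3) * X)
  rearrange = solve-∀

forests-ballot : ∀ k a → (3 * a + k) * forests k a ≡ k * binom (3 * a + k) a
forests-ballot zero    zero    = refl
forests-ballot zero    (suc a) = trans (*-zeroʳ (3 * suc a + 0)) (sym (*-zeroˡ (binom (3 * suc a + 0) (suc a))))
forests-ballot (suc k) zero    = cong (suc k *_) (forests-k-0 k)
forests-ballot (suc k) (suc a) =
  subst₂ (λ u v → u * (forests k (suc a) + forests (3 + k) a) ≡ suc k * binom v (suc a)) (sym (shift₂ a k)) (sym (shift₂ a k))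
    (ballot-step k a _ _ _ _
      (subst (λ u → u * forests k (suc a) ≡ k * binom u (suc a)) (shift₁ a k) (forests-ballot k (suc a)))
      (subst₂ (λ u v → u * forests (3 + k) a ≡ v * binom u a) (shift₃ a k) (+-comm 3 k) (forests-ballot (3 + k) a))
      (binom-absorption (3 * a + k + 3) a))
  where
  shift₁ : ∀ a k → 3 * suc a + k ≡ 3 * a + k + 3
  shift₁ = solve-∀
  shift₂ : ∀ a k → 3 * suc a + suc k ≡ suc (3 * a + k + 3)
  shift₂ = solve-∀
  shift₃ : ∀ a k → 3 * a + (3 + k) ≡ 3 * a + k + 3
  shift₃ = solve-∀

𝟙 : Bool → ℕ
𝟙 true  = 1
𝟙 false = 0

sumBy : {A : Set} → (A → ℕ) → List A → ℕ
sumBy f []       = 0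
sumBy f (x ∷ xs) = f x + sumBy f xs

private variable A B : Set

sumBy-cong : {f g : A → ℕ} → (∀ x → f x ≡ g x) → ∀ xs → sumBy f xs ≡ sumBy g xs
sumBy-cong h []       = refl
sumBy-cong h (x ∷ xs) = cong₂ _+_ (h x) (sumBy-cong h xs)

sumBy-zero : {f : A → ℕ} → (∀ x → f x ≡ 0) → ∀ xs → sumBy f xs ≡ 0
sumBy-zero h []       = refl
sumBy-zero h (x ∷ xs) = cong₂ _+_ (h x) (sumBy-zero h xs)

sumBy-++ : (f : A → ℕ) (xs ys : List A) → sumBy f (xs ++ ys) ≡ sumBy f xs + sumBy f ys
sumBy-++ f []       ys = refl
sumBy-++ f (x ∷ xs) ys = trans (cong (f x +_) (sumBy-++ f xs ys)) (sym (+-assoc (f x) _ _))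

sumBy-map : (f : B → ℕ) (g : A → B) (xs : List A) → sumBy f (map g xs) ≡ sumBy (λ x → f (g x)) xs
sumBy-map f g []       = refl
sumBy-map f g (x ∷ xs) = cong (f (g x) +_) (sumBy-map f g xs)

sumBy-concatMap : (f : B → ℕ) (g : A → List B) (xs : List A) →
  sumBy f (concatMap g xs) ≡ sumBy (λ x → sumBy f (g x)) xs
sumBy-concatMap f g []       = refl
sumBy-concatMap f g (x ∷ xs) =
  trans (sumBy-++ f (g x) (concatMap g xs)) (cong (sumBy f (g x) +_) (sumBy-concatMap f g xs))

sumBy-+ : (f g : A → ℕ) (xs : List A) → sumBy (λ x → f x + g x) xs ≡ sumBy f xs + sumBy g xs
sumBy-+ f g []       = refl
sumBy-+ f g (x ∷ xs) = trans (cong (f x + g x +_) (sumBy-+ f g xs)) (+-+-interchange (f x) (g x) _ _)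
  where
  +-+-interchange : ∀ a b c d → a + b + (c + d) ≡ a + c + (b + d)
  +-+-interchange = solve-∀

sumBy-*ˡ : (c : ℕ) (f : A → ℕ) (xs : List A) → sumBy (λ x → c * f x) xs ≡ c * sumBy f xs
sumBy-*ˡ c f []       = sym (*-zeroʳ c)
sumBy-*ˡ c f (x ∷ xs) = trans (cong (c * f x +_) (sumBy-*ˡ c f xs)) (sym (*-distribˡ-+ c (f x) (sumBy f xs)))

sumBy-comm : (f : A → B → ℕ) (xs : List A) (ys : List B) →
  sumBy (λ x → sumBy (f x) ys) xs ≡ sumBy (λ y → sumBy (λ x → f x y) xs) ys
sumBy-comm f []       ys = sym (sumBy-zero (λ _ → refl) ys)
sumBy-comm f (x ∷ xs) ys =
  trans (cong (sumBy (f x) ys +_) (sumBy-comm f xs ys)) (sym (sumBy-+ (f x) (λ y → sumBy (λ x → f x y) xs) ys))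

length-filterᵇ-filterᵇ : (p q : A → Bool) (xs : List A) →
  length (filterᵇ p (filterᵇ q xs)) ≡ sumBy (λ x → 𝟙 (q x) * 𝟙 (p x)) xs
length-filterᵇ-filterᵇ p q []       = refl
length-filterᵇ-filterᵇ p q (x ∷ xs) with q x
... | false = length-filterᵇ-filterᵇ p q xs
... | true with p x
...   | true  = cong suc (length-filterᵇ-filterᵇ p q xs)
...   | false = length-filterᵇ-filterᵇ p q xs

sumTrees : ℕ → (Tree → ℕ) → ℕ
sumTrees d f = sumBy f (treesOfHeight≤ d)

sumTrees³ : ℕ → (Tree → Tree → Tree → ℕ) → ℕ
sumTrees³ d g = sumTrees d (λ l → sumTrees d (λ c → sumTrees d (λ r → g l c r)))

sumTrees-cong : ∀ d {f g : Tree → ℕ} → (∀ t → f t ≡ g t) → sumTrees d f ≡ sumTrees d g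
sumTrees-cong d h = sumBy-cong h (treesOfHeight≤ d)

sumTrees-zero : ∀ d {f : Tree → ℕ} → (∀ t → f t ≡ 0) → sumTrees d f ≡ 0
sumTrees-zero d h = sumBy-zero h (treesOfHeight≤ d)

sumTrees³-zero : ∀ d {g : Tree → Tree → Tree → ℕ} → (∀ l c r → g l c r ≡ 0) → sumTrees³ d g ≡ 0
sumTrees³-zero d h = sumTrees-zero d (λ l → sumTrees-zero d (λ c → sumTrees-zero d (λ r → h l c r)))

sumTrees-suc : ∀ d f → sumTrees (suc d) f ≡ f ext + sumTrees³ d (λ l c r → f (int l c r))
sumTrees-suc d f = cong (f ext +_) (trans (sumBy-concatMap f _ ts)
  (sumBy-cong (λ l → trans (sumBy-concatMap f _ ts) (sumBy-cong (λ c → sumBy-map f (int l c) ts) ts)) ts))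
  where ts = treesOfHeight≤ d

VanishesAbove : ℕ → (Tree → ℕ) → Set
VanishesAbove d f = ∀ t → d < size t → f t ≡ 0

mutual
  sumTrees-stable : ∀ d f → VanishesAbove d f → sumTrees (suc d) f ≡ sumTrees d f
  sumTrees-stable zero    f h = trans (sumTrees-suc 0 f)
    (cong (f ext +_) (sumTrees³-zero 0 (λ l c r → h (int l c r) z<s)))
  sumTrees-stable (suc d) f h = trans (sumTrees-suc (suc d) f) (trans
    (cong (f ext +_) (sumTrees³-stable d (λ l c r → f (int l c r)) (λ l c r lt → h (int l c r) (s≤s lt))))
    (sym (sumTrees-suc d f)))

  sumTrees³-stable : ∀ d g → (∀ l c r → d < size l + size c + size r → g l c r ≡ 0) →
    sumTrees³ (suc d) g ≡ sumTrees³ d g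
  sumTrees³-stable d g h =
    trans (sumTrees-cong (suc d) (λ l → sumTrees-cong (suc d) (λ c → sumTrees-stable d _ (λ r lt →
             h l c r (<-≤-trans lt (m≤n+m _ _))))))
    (trans (sumTrees-cong (suc d) (λ l → sumTrees-stable d _ (λ c lt → sumTrees-zero d (λ r →
             h l c r (<-≤-trans lt (≤-trans (m≤n+m (size c) (size l)) (m≤m+n _ (size r))))))))
    (sumTrees-stable d _ (λ l lt → sumTrees-zero d (λ c → sumTrees-zero d (λ r →
             h l c r (<-≤-trans lt (≤-trans (m≤m+n _ _) (m≤m+n _ _))))))))

sumTrees-unfold : ∀ d f → VanishesAbove d f → sumTrees d f ≡ f ext + sumTrees³ d (λ l c r → f (int l c r))
sumTrees-unfold zero    f h = cong (f ext +_) (sym (sumTrees³-zero 0 (λ l c r → h (int l c r) z<s)))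
sumTrees-unfold (suc d) f h = trans (sumTrees-suc d f)
  (cong (f ext +_) (sym (sumTrees³-stable d (λ l c r → f (int l c r)) (λ l c r lt → h (int l c r) (s≤s lt)))))

-- Paths to external nodes

δ : ℕ → ℕ → ℕ
δ a b = 𝟙 (a ≡ᵇ b)

δ-refl : ∀ a → δ a a ≡ 1
δ-refl zero    = refl
δ-refl (suc a) = δ-refl a

δ-≢ : ∀ {a b} → a ≢ b → δ a b ≡ 0
δ-≢ {zero}  {zero}  a≢b = contradiction refl a≢b
δ-≢ {zero}  {suc b} _   = refl
δ-≢ {suc a} {zero}  _   = refl
δ-≢ {suc a} {suc b} a≢b = δ-≢ (λ a≡b → a≢b (cong suc a≡b))

δ-≡ : ∀ {a b} → a ≡ b → δ a b ≡ 1
δ-≡ {a} refl = δ-refl a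

δ-> : ∀ {a b} → b < a → δ a b ≡ 0
δ-> b<a = δ-≢ (λ a≡b → <-irrefl (sym a≡b) b<a)

weightAt : (A → ℕ) → List A → ℕ → ℕ → ℕ
weightAt f []       o s = 0
weightAt f (x ∷ xs) o s = δ o s * f x + weightAt f xs (suc o) s

weightAt-cong : {f g : A → ℕ} → (∀ x → f x ≡ g x) → ∀ xs o s → weightAt f xs o s ≡ weightAt g xs o s
weightAt-cong h []       o s = refl
weightAt-cong h (x ∷ xs) o s = cong₂ (λ u v → δ o s * u + v) (h x) (weightAt-cong h xs (suc o) s)

weightAt-zero : {f : A → ℕ} → (∀ x → f x ≡ 0) → ∀ xs o s → weightAt f xs o s ≡ 0
weightAt-zero h []       o s = refl
weightAt-zero h (x ∷ xs) o s =
  cong₂ _+_ (trans (cong (δ o s *_) (h x)) (*-zeroʳ (δ o s))) (weightAt-zero h xs (suc o) s)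

weightAt-map : (f : B → ℕ) (g : A → B) → ∀ xs o s → weightAt f (map g xs) o s ≡ weightAt (λ x → f (g x)) xs o s
weightAt-map f g []       o s = refl
weightAt-map f g (x ∷ xs) o s = cong (δ o s * f (g x) +_) (weightAt-map f g xs (suc o) s)

weightAt-++ : (f : A → ℕ) → ∀ xs ys o s →
  weightAt f (xs ++ ys) o s ≡ weightAt f xs o s + weightAt f ys (o + length xs) s
weightAt-++ f []       ys o s = cong (λ o′ → weightAt f ys o′ s) (sym (+-identityʳ o))
weightAt-++ f (x ∷ xs) ys o s = begin
  δ o s * f x + weightAt f (xs ++ ys) (suc o) s
    ≡⟨ cong (δ o s * f x +_) (weightAt-++ f xs ys (suc o) s) ⟩
  δ o s * f x + (weightAt f xs (suc o) s + weightAt f ys (suc o + length xs) s)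
    ≡⟨ sym (+-assoc (δ o s * f x) _ _) ⟩
  δ o s * f x + weightAt f xs (suc o) s + weightAt f ys (suc o + length xs) s
    ≡⟨ cong (λ o′ → δ o s * f x + weightAt f xs (suc o) s + weightAt f ys o′ s) (sym (+-suc o (length xs))) ⟩
  δ o s * f x + weightAt f xs (suc o) s + weightAt f ys (o + length (x ∷ xs)) s ∎
  where open ≡-Reasoning

weightAt-atPred : ∀ m (h : ℕ → A → ℕ) xs o s →
  weightAt (λ x → atPred m (λ k → h k x)) xs o s ≡ atPred m (λ k → weightAt (h k) xs o s)
weightAt-atPred zero    h xs o s = weightAt-zero (λ _ → refl) xs o s
weightAt-atPred (suc m) h xs o s = refl

weightAt-below : (f : A → ℕ) → ∀ xs {o s} → s < o → weightAt f xs o s ≡ 0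
weightAt-below f []       s<o = refl
weightAt-below f (x ∷ xs) s<o =
  cong₂ _+_ (cong (_* f x) (δ-> s<o)) (weightAt-below f xs (m<n⇒m<1+n s<o))

weightAt-nth : (f : A → ℕ) → ∀ xs o p → weightAt f xs o (o + p) ≡ maybe′ f 0 (nth xs p)
weightAt-nth f []       o p       = refl
weightAt-nth f (x ∷ xs) o zero    = begin
  δ o (o + 0) * f x + weightAt f xs (suc o) (o + 0)
    ≡⟨ cong₂ (λ u v → u * f x + v) (δ-≡ (sym (+-identityʳ o)))
             (weightAt-below f xs (subst (_< suc o) (sym (+-identityʳ o)) (n<1+n o))) ⟩
  1 * f x + 0
    ≡⟨ trans (+-identityʳ _) (*-identityˡ _) ⟩
  f x ∎
  where open ≡-Reasoning
weightAt-nth f (x ∷ xs) o (suc p) =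
  cong₂ _+_ (cong (_* f x) (δ-≢ (m≢1+m+n o ∘ (λ e → trans e (+-suc o p)))))
            (trans (cong (λ s → weightAt f xs (suc o) s) (+-suc o p)) (weightAt-nth f xs (suc o) p))

weightAt-++³ : (f : A → ℕ) → ∀ xs ys zs o s →
  weightAt f (xs ++ ys ++ zs) o s
    ≡ weightAt f xs o s + weightAt f ys (o + length xs) s + weightAt f zs (o + length xs + length ys) s
weightAt-++³ f xs ys zs o s =
  trans (weightAt-++ f xs (ys ++ zs) o s)
  (trans (cong (weightAt f xs o s +_) (weightAt-++ f ys zs (o + length xs) s))
         (sym (+-assoc (weightAt f xs o s) _ _)))

hasCounts : ℕ → ℕ → ℕ → List Edge → ℕ
hasCounts m₁ m₂ m₃ w = 𝟙 ((countE isE₁ w ≡ᵇ m₁) ∧ (countE isE₂ w ≡ᵇ m₂) ∧ (countE isE₃ w ≡ᵇ m₃))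

hasCounts-e₁∷ : ∀ m₁ m₂ m₃ w → hasCounts m₁ m₂ m₃ (e₁ ∷ w) ≡ atPred m₁ (λ k → hasCounts k m₂ m₃ w)
hasCounts-e₁∷ zero    m₂ m₃ w = refl
hasCounts-e₁∷ (suc m₁) m₂ m₃ w = refl

hasCounts-e₂∷ : ∀ m₁ m₂ m₃ w → hasCounts m₁ m₂ m₃ (e₂ ∷ w) ≡ atPred m₂ (λ k → hasCounts m₁ k m₃ w)
hasCounts-e₂∷ m₁ zero     m₃ w with countE isE₁ w ≡ᵇ m₁
... | true  = refl
... | false = refl
hasCounts-e₂∷ m₁ (suc m₂) m₃ w = refl

hasCounts-e₃∷ : ∀ m₁ m₂ m₃ w → hasCounts m₁ m₂ m₃ (e₃ ∷ w) ≡ atPred m₃ (λ k → hasCounts m₁ m₂ k w)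
hasCounts-e₃∷ m₁ m₂ zero     w with countE isE₁ w ≡ᵇ m₁ | countE isE₂ w ≡ᵇ m₂
... | true  | true  = refl
... | true  | false = refl
... | false | _     = refl
hasCounts-e₃∷ m₁ m₂ (suc m₃) w = refl

hasCounts-[] : ∀ m₁ m₂ m₃ → 1 ≤ m₁ + m₂ + m₃ → hasCounts m₁ m₂ m₃ [] ≡ 0
hasCounts-[] zero     zero     (suc m₃) _ = refl
hasCounts-[] zero     (suc m₂) m₃       _ = refl
hasCounts-[] (suc m₁) m₂       m₃       _ = refl

𝟙-pathHas : ∀ s m₁ m₂ m₃ t → 𝟙 (pathHas s m₁ m₂ m₃ t) ≡ maybe′ (hasCounts m₁ m₂ m₃) 0 (pathTo t s)
𝟙-pathHas s m₁ m₂ m₃ t with pathTo t s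
... | nothing = refl
... | just w  = refl

#ext : Tree → ℕ
#ext t = 2 * size t + 1

length-extPaths : ∀ t → length (extPaths t) ≡ #ext t
length-extPaths ext         = refl
length-extPaths (int l c r) = begin
  length (Ls ++ Cs ++ Rs)                   ≡⟨ length-++ Ls ⟩
  length Ls + length (Cs ++ Rs)             ≡⟨ cong (length Ls +_) (length-++ Cs) ⟩
  length Ls + (length Cs + length Rs)       ≡⟨ cong₂ _+_ (length-map-extPaths l) (cong₂ _+_ (length-map-extPaths c) (length-map-extPaths r)) ⟩
  #ext l + (#ext c + #ext r)             ≡⟨ sizes (size l) (size c) (size r) ⟩
  #ext (int l c r)                       ∎
  where
  open ≡-Reasoning
  Ls = map (e₁ ∷_) (extPaths l)
  Cs = map (e₂ ∷_) (extPaths c)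
  Rs = map (e₃ ∷_) (extPaths r)
  length-map-extPaths : ∀ {e} t → length (map (e ∷_) (extPaths t)) ≡ #ext t
  length-map-extPaths t = trans (length-map _ (extPaths t)) (length-extPaths t)
  sizes : ∀ a b c → (2 * a + 1) + ((2 * b + 1) + (2 * c + 1)) ≡ 2 * suc (a + b + c) + 1
  sizes = solve-∀

-- pathCount t o s m₁ m₂ m₃ is 1 if, numbering the external nodes of t from o, there is an
-- external node s whose path has m₁ left, m₂ center and m₃ right edges, and 0 otherwise.
pathCount : Tree → ℕ → ℕ → ℕ → ℕ → ℕ → ℕ
pathCount ext         o s m₁ m₂ m₃ = δ o s * hasCounts m₁ m₂ m₃ []
pathCount (int l c r) o s m₁ m₂ m₃ =
    atPred m₁ (λ k → pathCount l o s k m₂ m₃)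
  + atPred m₂ (λ k → pathCount c (o + #ext l) s m₁ k m₃)
  + atPred m₃ (λ k → pathCount r (o + #ext l + #ext c) s m₁ m₂ k)

pathCount≡weightAt : ∀ t o s m₁ m₂ m₃ → pathCount t o s m₁ m₂ m₃ ≡ weightAt (hasCounts m₁ m₂ m₃) (extPaths t) o s
pathCount≡weightAt ext         o s m₁ m₂ m₃ = sym (+-identityʳ _)
pathCount≡weightAt (int l c r) o s m₁ m₂ m₃ = sym (begin
  weightAt hc (Ls ++ Cs ++ Rs) o s
    ≡⟨ weightAt-++³ hc Ls Cs Rs o s ⟩
  weightAt hc Ls o s + weightAt hc Cs (o + length Ls) s + weightAt hc Rs (o + length Ls + length Cs) s
    ≡⟨ cong₂ (λ a b → weightAt hc Ls o s + weightAt hc Cs (o + a) s + weightAt hc Rs (o + a + b) s)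
             (trans (length-map _ (extPaths l)) (length-extPaths l))
             (trans (length-map _ (extPaths c)) (length-extPaths c)) ⟩
  weightAt hc Ls o s + weightAt hc Cs (o + #ext l) s + weightAt hc Rs (o + #ext l + #ext c) s
    ≡⟨ cong₂ _+_ (cong₂ _+_ left center) right ⟩
  pathCount (int l c r) o s m₁ m₂ m₃ ∎)
  where
  open ≡-Reasoning
  hc = hasCounts m₁ m₂ m₃
  Ls = map (e₁ ∷_) (extPaths l)
  Cs = map (e₂ ∷_) (extPaths c)
  Rs = map (e₃ ∷_) (extPaths r)
  left : weightAt hc Ls o s ≡ atPred m₁ (λ k → pathCount l o s k m₂ m₃)
  left = trans (weightAt-map hc (e₁ ∷_) (extPaths l) o s)
    (trans (weightAt-cong (hasCounts-e₁∷ m₁ m₂ m₃) (extPaths l) o s)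
    (trans (weightAt-atPred m₁ (λ k → hasCounts k m₂ m₃) (extPaths l) o s)
           (atPred-cong m₁ (λ k → sym (pathCount≡weightAt l o s k m₂ m₃)))))
  center : weightAt hc Cs (o + #ext l) s ≡ atPred m₂ (λ k → pathCount c (o + #ext l) s m₁ k m₃)
  center = trans (weightAt-map hc (e₂ ∷_) (extPaths c) _ s)
    (trans (weightAt-cong (hasCounts-e₂∷ m₁ m₂ m₃) (extPaths c) _ s)
    (trans (weightAt-atPred m₂ (λ k → hasCounts m₁ k m₃) (extPaths c) _ s)
           (atPred-cong m₂ (λ k → sym (pathCount≡weightAt c _ s m₁ k m₃)))))
  right : weightAt hc Rs (o + #ext l + #ext c) s ≡ atPred m₃ (λ k → pathCount r (o + #ext l + #ext c) s m₁ m₂ k)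
  right = trans (weightAt-map hc (e₃ ∷_) (extPaths r) _ s)
    (trans (weightAt-cong (hasCounts-e₃∷ m₁ m₂ m₃) (extPaths r) _ s)
    (trans (weightAt-atPred m₃ (λ k → hasCounts m₁ m₂ k) (extPaths r) _ s)
           (atPred-cong m₃ (λ k → sym (pathCount≡weightAt r _ s m₁ m₂ k)))))

𝟙-pathHas≡pathCount : ∀ s m₁ m₂ m₃ t → 𝟙 (pathHas s m₁ m₂ m₃ t) ≡ pathCount t 0 s m₁ m₂ m₃
𝟙-pathHas≡pathCount s m₁ m₂ m₃ t =
  trans (𝟙-pathHas s m₁ m₂ m₃ t)
  (trans (sym (weightAt-nth (hasCounts m₁ m₂ m₃) (extPaths t) 0 s)) (sym (pathCount≡weightAt t 0 s m₁ m₂ m₃)))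

-- Cutting a tree along a path

sumTrees-+ : ∀ d (f g : Tree → ℕ) → sumTrees d (λ t → f t + g t) ≡ sumTrees d f + sumTrees d g
sumTrees-+ d f g = sumBy-+ f g (treesOfHeight≤ d)

sumTrees-*ˡ : ∀ d c (f : Tree → ℕ) → sumTrees d (λ t → c * f t) ≡ c * sumTrees d f
sumTrees-*ˡ d c f = sumBy-*ˡ c f (treesOfHeight≤ d)

sumTrees-comm : ∀ d (f : Tree → Tree → ℕ) →
  sumTrees d (λ t → sumTrees d (f t)) ≡ sumTrees d (λ u → sumTrees d (λ t → f t u))
sumTrees-comm d f = sumBy-comm f (treesOfHeight≤ d) (treesOfHeight≤ d)

sumTrees³-+ : ∀ d (f g h : Tree → Tree → Tree → ℕ) →
  sumTrees³ d (λ l c r → f l c r + g l c r + h l c r) ≡ sumTrees³ d f + sumTrees³ d g + sumTrees³ d h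
sumTrees³-+ d f g h = trans (sumTrees-cong d (λ l → trans (sumTrees-cong d (λ c → +³ (λ r → f l c r) (λ r → g l c r) (λ r → h l c r)))
                                                   (+³ (λ c → sumTrees d (f l c)) _ _)))
                            (+³ _ _ _)
  where
  +³ : ∀ (f g h : Tree → ℕ) → sumTrees d (λ t → f t + g t + h t) ≡ sumTrees d f + sumTrees d g + sumTrees d h
  +³ f g h = trans (sumTrees-+ d _ h) (cong (_+ sumTrees d h) (sumTrees-+ d f g))

totalSize : List Tree → ℕ
totalSize []       = 0
totalSize (t ∷ ts) = size t + totalSize ts

-- Sums range over the trees of height at most N, which include all trees of size at most N;
-- the counts below are exact for sizes n ≤ N, and are used with N = n.
module Decomposition (N : ℕ) where

  Σt : (Tree → ℕ) → ℕ
  Σt = sumTrees N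

  Σt³ : (Tree → Tree → Tree → ℕ) → ℕ
  Σt³ = sumTrees³ N

  forestSum : ℕ → (List Tree → ℕ) → ℕ
  forestSum zero    g = g []
  forestSum (suc k) g = Σt (λ t → forestSum k (λ ts → g (t ∷ ts)))

  forestSum-cong : ∀ k {f g : List Tree → ℕ} → (∀ ts → f ts ≡ g ts) → forestSum k f ≡ forestSum k g
  forestSum-cong zero    h = h []
  forestSum-cong (suc k) h = sumTrees-cong N (λ t → forestSum-cong k (λ ts → h (t ∷ ts)))

  forestSum-zero : ∀ k {f : List Tree → ℕ} → (∀ ts → f ts ≡ 0) → forestSum k f ≡ 0
  forestSum-zero zero    h = h []
  forestSum-zero (suc k) h = sumTrees-zero N (λ t → forestSum-zero k (λ ts → h (t ∷ ts)))

  forestSum-+ : ∀ k (f g : List Tree → ℕ) → forestSum k (λ ts → f ts + g ts) ≡ forestSum k f + forestSum k g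
  forestSum-+ zero    f g = refl
  forestSum-+ (suc k) f g = trans (sumTrees-cong N (λ t → forestSum-+ k _ _)) (sumTrees-+ N _ _)

  forestSum-*ˡ : ∀ k c (f : List Tree → ℕ) → forestSum k (λ ts → c * f ts) ≡ c * forestSum k f
  forestSum-*ˡ zero    c f = refl
  forestSum-*ˡ (suc k) c f = trans (sumTrees-cong N (λ t → forestSum-*ˡ k c _)) (sumTrees-*ˡ N c _)

  forestSum-*ʳ : ∀ k c (f : List Tree → ℕ) → forestSum k (λ ts → f ts * c) ≡ forestSum k f * c
  forestSum-*ʳ k c f = trans (forestSum-cong k (λ ts → *-comm (f ts) c)) (trans (forestSum-*ˡ k c f) (*-comm c _))

  forestSum-Σt-comm : ∀ k (f : List Tree → Tree → ℕ) → forestSum k (λ ts → Σt (f ts)) ≡ Σt (λ t → forestSum k (λ ts → f ts t))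
  forestSum-Σt-comm zero    f = refl
  forestSum-Σt-comm (suc k) f =
    trans (sumTrees-cong N (λ u → forestSum-Σt-comm k (λ ts → f (u ∷ ts)))) (sumTrees-comm N _)

  forestCount : ℕ → ℕ → ℕ
  forestCount k a = forestSum k (λ ts → δ (totalSize ts) a)

  private
    countTerm-vanishesAbove : ∀ k a → a ≤ N → VanishesAbove N (λ t → forestSum k (λ ts → δ (size t + totalSize ts) a))
    countTerm-vanishesAbove k a a≤N t N<t = forestSum-zero k (λ ts → δ-> (<-≤-trans (≤-<-trans a≤N N<t) (m≤m+n _ _)))

  forestCount-suc-0 : ∀ k → forestCount (suc k) 0 ≡ forestCount k 0
  forestCount-suc-0 k = trans (sumTrees-unfold N _ (countTerm-vanishesAbove k 0 z≤n))
    (trans (cong (forestCount k 0 +_) (sumTrees³-zero N (λ l c r → forestSum-zero k (λ ts → refl)))) (+-identityʳ _))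

  forestCount-suc-suc : ∀ k a → suc a ≤ N → forestCount (suc k) (suc a) ≡ forestCount k (suc a) + forestCount (3 + k) a
  forestCount-suc-suc k a a<N = trans (sumTrees-unfold N _ (countTerm-vanishesAbove k (suc a) a<N))
    (cong (forestCount k (suc a) +_) (sumTrees-cong N (λ l → sumTrees-cong N (λ c → sumTrees-cong N (λ r →
      forestSum-cong k (λ ts → cong (λ x → δ x a) (reassoc (size l) (size c) (size r) (totalSize ts))))))))
    where
    reassoc : ∀ a b c d → a + b + c + d ≡ a + (b + (c + d))
    reassoc = solve-∀

  forestCount≡forests : ∀ k a → a ≤ N → forestCount k a ≡ forests k a
  forestCount≡forests zero    zero    _   = refl
  forestCount≡forests zero    (suc a) _   = refl
  forestCount≡forests (suc k) zero    a≤N = trans (forestCount-suc-0 k) (forestCount≡forests k zero a≤N)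
  forestCount≡forests (suc k) (suc a) a<N = trans (forestCount-suc-suc k a a<N)
    (cong₂ _+_ (forestCount≡forests k (suc a) a<N) (forestCount≡forests (3 + k) a (≤-trans (n≤1+n a) a<N)))

  -- 2 * totalSize L + kL is the number of external nodes of a forest L of kL trees.
  flankCount : ℕ → ℕ → ℕ → ℕ → ℕ
  flankCount kL kR n s = forestSum kL (λ L → forestSum kR (λ R →
    δ (totalSize L + totalSize R) n * δ (2 * totalSize L + kL) s))

  flankCount-hit : ∀ kL kR n a → a ≤ n → flankCount kL kR n (2 * a + kL) ≡ forestCount kL a * forestCount kR (n ∸ a)
  flankCount-hit kL kR n a a≤n =
    trans (forestSum-cong kL (λ L → trans (forestSum-cong kR (λ R → split (totalSize L) (totalSize R)))
                                          (forestSum-*ˡ kR (δ (totalSize L) a) (λ R → δ (totalSize R) (n ∸ a)))))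
          (forestSum-*ʳ kL (forestCount kR (n ∸ a)) (λ L → δ (totalSize L) a))
    where
    δ-+ : ∀ x y n → x ≤ n → δ (x + y) n ≡ δ y (n ∸ x)
    δ-+ zero    y n       _         = refl
    δ-+ (suc x) y (suc n) (s≤s x≤n) = δ-+ x y n x≤n
    split : ∀ x y → δ (x + y) n * δ (2 * x + kL) (2 * a + kL) ≡ δ x a * δ y (n ∸ a)
    split x y with x ≟ a
    ... | yes refl = begin
      δ (x + y) n * δ (2 * x + kL) (2 * x + kL) ≡⟨ cong₂ _*_ (δ-+ x y n a≤n) (δ-refl (2 * x + kL)) ⟩
      δ y (n ∸ x) * 1                           ≡⟨ *-identityʳ _ ⟩
      δ y (n ∸ x)                               ≡⟨ sym (trans (cong (_* δ y (n ∸ x)) (δ-refl x)) (+-identityʳ _)) ⟩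
      δ x x * δ y (n ∸ x)                       ∎
      where open ≡-Reasoning
    ... | no x≢a = trans (cong (δ (x + y) n *_) (δ-≢ (x≢a ∘ *-cancelˡ-≡ x a 2 ∘ +-cancelʳ-≡ kL _ _)))
                   (trans (*-zeroʳ (δ (x + y) n)) (sym (cong (_* δ y (n ∸ a)) (δ-≢ x≢a))))

  flankCount-miss : ∀ kL kR n s → (∀ a → a ≤ n → s ≢ 2 * a + kL) → flankCount kL kR n s ≡ 0
  flankCount-miss kL kR n s miss = forestSum-zero kL (λ L → forestSum-zero kR (λ R → vanish L R))
    where
    vanish : ∀ L R → δ (totalSize L + totalSize R) n * δ (2 * totalSize L + kL) s ≡ 0
    vanish L R with totalSize L + totalSize R ≟ n
    ... | no  ≢n = cong (_* δ (2 * totalSize L + kL) s) (δ-≢ ≢n)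
    ... | yes ≡n = trans (cong (δ (totalSize L + totalSize R) n *_)
                           (δ-≢ (miss (totalSize L) (subst (totalSize L ≤_) ≡n (m≤m+n _ _)) ∘ sym)))
                         (*-zeroʳ (δ (totalSize L + totalSize R) n))

  -- contextCount kL kR n s m₁ m₂ m₃ counts forests L, t, R (L of kL trees, then one tree t, then
  -- R of kR trees) with n internal nodes in total, in which external node s of the whole forest
  -- lies in t and its path from the root of t has m₁ left, m₂ center and m₃ right edges.
  contextCount : ℕ → ℕ → ℕ → ℕ → ℕ → ℕ → ℕ → ℕ
  contextCount kL kR n s m₁ m₂ m₃ = forestSum kL (λ L → Σt (λ t → forestSum kR (λ R →
    δ (totalSize L + size t + totalSize R) n * pathCount t (2 * totalSize L + kL) s m₁ m₂ m₃)))

  nodeContext : ℕ → ℕ → ℕ → (List Tree → Tree → Tree → Tree → ℕ) → ℕ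
  nodeContext kL kR n g = forestSum kL (λ L → Σt³ (λ l c r → forestSum kR (λ R →
    δ (totalSize L + size (int l c r) + totalSize R) n * g L l c r)))

  nodeContext-+³ : ∀ kL kR n (f g h : List Tree → Tree → Tree → Tree → ℕ) →
    nodeContext kL kR n (λ L l c r → f L l c r + g L l c r + h L l c r)
      ≡ nodeContext kL kR n f + nodeContext kL kR n g + nodeContext kL kR n h
  nodeContext-+³ kL kR n f g h =
    trans (forestSum-cong kL (λ L → trans (sumTrees-cong N (λ l → sumTrees-cong N (λ c → sumTrees-cong N (λ r →
             trans (forestSum-cong kR (λ R → distrib (dd L l c r R) _ _ _)) (+³ kR _ _ _)))))
             (sumTrees³-+ N _ _ _)))
          (+³ kL _ _ _)
    where
    dd : List Tree → Tree → Tree → Tree → List Tree → ℕ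
    dd L l c r R = δ (totalSize L + size (int l c r) + totalSize R) n
    distrib : ∀ x a b c → x * (a + b + c) ≡ x * a + x * b + x * c
    distrib = solve-∀
    +³ : ∀ k (f g h : List Tree → ℕ) → forestSum k (λ x → f x + g x + h x) ≡ forestSum k f + forestSum k g + forestSum k h
    +³ k f g h = trans (forestSum-+ k _ h) (cong (_+ forestSum k h) (forestSum-+ k f g))

  nodeContext-0 : ∀ kL kR g → nodeContext kL kR 0 g ≡ 0
  nodeContext-0 kL kR g = forestSum-zero kL (λ L → sumTrees³-zero N (λ l c r → forestSum-zero kR (λ R →
    cong (_* g L l c r) (δ-> (<-≤-trans z<s (≤-trans (m≤n+m (size (int l c r)) (totalSize L)) (m≤m+n _ (totalSize R))))))))

  contextCount-split : ∀ kL kR n s m₁ m₂ m₃ → n ≤ N →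
    contextCount kL kR n s m₁ m₂ m₃
      ≡ hasCounts m₁ m₂ m₃ [] * flankCount kL kR n s
        + nodeContext kL kR n (λ L l c r → pathCount (int l c r) (2 * totalSize L + kL) s m₁ m₂ m₃)
  contextCount-split kL kR n s m₁ m₂ m₃ n≤N =
    trans (forestSum-cong kL (λ L → trans (sumTrees-unfold N _ (vanishesAbove L)) (cong (_+ node L) (leaf L))))
    (trans (forestSum-+ kL _ _) (cong (_+ forestSum kL node) (forestSum-*ˡ kL h₀ _)))
    where
    h₀ = hasCounts m₁ m₂ m₃ []
    node : List Tree → ℕ
    node L = Σt³ (λ l c r → forestSum kR (λ R →
      δ (totalSize L + size (int l c r) + totalSize R) n * pathCount (int l c r) (2 * totalSize L + kL) s m₁ m₂ m₃))
    vanishesAbove : ∀ L → VanishesAbove N (λ t → forestSum kR (λ R →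
      δ (totalSize L + size t + totalSize R) n * pathCount t (2 * totalSize L + kL) s m₁ m₂ m₃))
    vanishesAbove L t N<t = forestSum-zero kR (λ R → cong (_* pathCount t (2 * totalSize L + kL) s m₁ m₂ m₃)
      (δ-> (<-≤-trans (≤-<-trans n≤N N<t) (≤-trans (m≤n+m (size t) (totalSize L)) (m≤m+n _ (totalSize R))))))
    leaf : ∀ L → forestSum kR (λ R → δ (totalSize L + 0 + totalSize R) n * (δ (2 * totalSize L + kL) s * h₀))
               ≡ h₀ * forestSum kR (λ R → δ (totalSize L + totalSize R) n * δ (2 * totalSize L + kL) s)
    leaf L = trans (forestSum-cong kR (λ R →
        trans (cong (λ x → δ (x + totalSize R) n * (δ (2 * totalSize L + kL) s * h₀)) (+-identityʳ (totalSize L)))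
              (rotate (δ (totalSize L + totalSize R) n) (δ (2 * totalSize L + kL) s) h₀)))
      (forestSum-*ˡ kR h₀ _)
      where
      rotate : ∀ a b c → a * (b * c) ≡ c * (a * b)
      rotate = solve-∀

  nodeContext-zero : ∀ kL kR n {g : List Tree → Tree → Tree → Tree → ℕ} →
    (∀ L l c r → g L l c r ≡ 0) → nodeContext kL kR n g ≡ 0
  nodeContext-zero kL kR n g≡0 = forestSum-zero kL (λ L → sumTrees³-zero N (λ l c r → forestSum-zero kR (λ R →
    trans (cong (δ (totalSize L + size (int l c r) + totalSize R) n *_) (g≡0 L l c r)) (*-zeroʳ (δ (totalSize L + size (int l c r) + totalSize R) n)))))

  private
    left-edge : ∀ L l c r R → L + suc (l + c + r) + R ≡ suc (L + l + (c + (r + R)))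
    left-edge = solve-∀
    center-edge : ∀ L l c r R → L + suc (l + c + r) + R ≡ suc (l + L + c + (r + R))
    center-edge = solve-∀
    right-edge : ∀ L l c r R → L + suc (l + c + r) + R ≡ suc (l + (c + L) + r + R)
    right-edge = solve-∀
    center-offset : ∀ L kL l → 2 * L + kL + (2 * l + 1) ≡ 2 * (l + L) + suc kL
    center-offset = solve-∀
    right-offset : ∀ L kL l c → 2 * L + kL + (2 * l + 1) + (2 * c + 1) ≡ 2 * (l + (c + L)) + suc (suc kL)
    right-offset = solve-∀

  -- Below the root, the two siblings of the child on the path join the left or right context.
  nodeContext-left : ∀ kL kR n s m₁ m₂ m₃ →
    nodeContext kL kR (suc n) (λ L l c r → atPred m₁ (λ k → pathCount l (2 * totalSize L + kL) s k m₂ m₃))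
      ≡ atPred m₁ (λ k → contextCount kL (2 + kR) n s k m₂ m₃)
  nodeContext-left kL kR n s zero    m₂ m₃ = nodeContext-zero kL kR (suc n) (λ _ _ _ _ → refl)
  nodeContext-left kL kR n s (suc k) m₂ m₃ =
    forestSum-cong kL (λ L → sumTrees-cong N (λ l → sumTrees-cong N (λ c → sumTrees-cong N (λ r → forestSum-cong kR (λ R →
      cong (λ x → δ x (suc n) * pathCount l (2 * totalSize L + kL) s k m₂ m₃)
           (left-edge (totalSize L) (size l) (size c) (size r) (totalSize R)))))))

  nodeContext-center : ∀ kL kR n s m₁ m₂ m₃ →
    nodeContext kL kR (suc n) (λ L l c r → atPred m₂ (λ k → pathCount c (2 * totalSize L + kL + #ext l) s m₁ k m₃))
      ≡ atPred m₂ (λ k → contextCount (suc kL) (suc kR) n s m₁ k m₃)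
  nodeContext-center kL kR n s m₁ zero    m₃ = nodeContext-zero kL kR (suc n) (λ _ _ _ _ → refl)
  nodeContext-center kL kR n s m₁ (suc k) m₃ =
    trans (forestSum-Σt-comm kL _) (sumTrees-cong N (λ l → forestSum-cong kL (λ L → sumTrees-cong N (λ c →
      sumTrees-cong N (λ r → forestSum-cong kR (λ R →
        cong₂ (λ x o → δ x (suc n) * pathCount c o s m₁ k m₃)
              (center-edge (totalSize L) (size l) (size c) (size r) (totalSize R))
              (center-offset (totalSize L) kL (size l))))))))

  nodeContext-right : ∀ kL kR n s m₁ m₂ m₃ →
    nodeContext kL kR (suc n) (λ L l c r → atPred m₃ (λ k → pathCount r (2 * totalSize L + kL + #ext l + #ext c) s m₁ m₂ k))
      ≡ atPred m₃ (λ k → contextCount (2 + kL) kR n s m₁ m₂ k)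
  nodeContext-right kL kR n s m₁ m₂ zero    = nodeContext-zero kL kR (suc n) (λ _ _ _ _ → refl)
  nodeContext-right kL kR n s m₁ m₂ (suc k) =
    trans (forestSum-Σt-comm kL _) (sumTrees-cong N (λ l → trans (forestSum-Σt-comm kL _) (sumTrees-cong N (λ c →
      forestSum-cong kL (λ L → sumTrees-cong N (λ r → forestSum-cong kR (λ R →
        cong₂ (λ x o → δ x (suc n) * pathCount r o s m₁ m₂ k)
              (right-edge (totalSize L) (size l) (size c) (size r) (totalSize R))
              (right-offset (totalSize L) kL (size l) (size c)))))))))

  contextCount-suc : ∀ kL kR n s m₁ m₂ m₃ → suc n ≤ N →
    contextCount kL kR (suc n) s m₁ m₂ m₃
      ≡ hasCounts m₁ m₂ m₃ [] * flankCount kL kR (suc n) s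
        + (atPred m₁ (λ k → contextCount kL (2 + kR) n s k m₂ m₃)
           + atPred m₂ (λ k → contextCount (suc kL) (suc kR) n s m₁ k m₃)
           + atPred m₃ (λ k → contextCount (2 + kL) kR n s m₁ m₂ k))
  contextCount-suc kL kR n s m₁ m₂ m₃ n<N =
    trans (contextCount-split kL kR (suc n) s m₁ m₂ m₃ n<N)
          (cong (hasCounts m₁ m₂ m₃ [] * flankCount kL kR (suc n) s +_)
                (trans (nodeContext-+³ kL kR (suc n) _ _ _)
                       (cong₂ _+_ (cong₂ _+_ (nodeContext-left kL kR n s m₁ m₂ m₃) (nodeContext-center kL kR n s m₁ m₂ m₃))
                                  (nodeContext-right kL kR n s m₁ m₂ m₃))))

  contextCount-0 : ∀ kL kR s m₁ m₂ m₃ → contextCount kL kR 0 s m₁ m₂ m₃ ≡ hasCounts m₁ m₂ m₃ [] * flankCount kL kR 0 s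
  contextCount-0 kL kR s m₁ m₂ m₃ =
    trans (contextCount-split kL kR 0 s m₁ m₂ m₃ z≤n)
          (trans (cong (hasCounts m₁ m₂ m₃ [] * flankCount kL kR 0 s +_) (nodeContext-0 kL kR _)) (+-identityʳ _))

  contextCount-nil : ∀ kL kR n s → n ≤ N → contextCount kL kR n s 0 0 0 ≡ flankCount kL kR n s
  contextCount-nil kL kR n s n≤N =
    trans (contextCount-split kL kR n s 0 0 0 n≤N)
          (trans (cong (1 * flankCount kL kR n s +_) (nodeContext-zero kL kR n (λ _ _ _ _ → refl)))
                 (trans (+-identityʳ _) (*-identityˡ _)))

  contextCount-vanishes : ∀ n → n ≤ N → ∀ kL kR s m₁ m₂ m₃ → n < m₁ + m₂ + m₃ → contextCount kL kR n s m₁ m₂ m₃ ≡ 0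
  contextCount-vanishes zero    _   kL kR s m₁ m₂ m₃ 0<M =
    trans (contextCount-0 kL kR s m₁ m₂ m₃) (cong (_* flankCount kL kR 0 s) (hasCounts-[] m₁ m₂ m₃ 0<M))
  contextCount-vanishes (suc n) n<N kL kR s m₁ m₂ m₃ n<M =
    trans (contextCount-suc kL kR n s m₁ m₂ m₃ n<N)
          (cong₂ _+_ (cong (_* flankCount kL kR (suc n) s) (hasCounts-[] m₁ m₂ m₃ (≤-trans (s≤s z≤n) n<M)))
                     (cong₂ _+_ (cong₂ _+_ (left m₁ n<M) (center m₂ n<M)) (right m₃ n<M)))
    where
    n≤N = ≤-trans (n≤1+n n) n<N
    left : ∀ m₁ → suc n < m₁ + m₂ + m₃ → atPred m₁ (λ k → contextCount kL (2 + kR) n s k m₂ m₃) ≡ 0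
    left zero    _         = refl
    left (suc k) (s≤s n<M) = contextCount-vanishes n n≤N kL (2 + kR) s k m₂ m₃ n<M
    center : ∀ m₂ → suc n < m₁ + m₂ + m₃ → atPred m₂ (λ k → contextCount (suc kL) (suc kR) n s m₁ k m₃) ≡ 0
    center zero    _   = refl
    center (suc k) n<M =
      contextCount-vanishes n n≤N (suc kL) (suc kR) s m₁ k m₃ (≤-pred (subst (suc (suc n) ≤_) (cong (_+ m₃) (+-suc m₁ k)) n<M))
    right : ∀ m₃ → suc n < m₁ + m₂ + m₃ → atPred m₃ (λ k → contextCount (2 + kL) kR n s m₁ m₂ k) ≡ 0
    right zero    _   = refl
    right (suc k) n<M =
      contextCount-vanishes n n≤N (2 + kL) kR s m₁ m₂ k (≤-pred (subst (suc (suc n) ≤_) (+-suc (m₁ + m₂) k) n<M))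

  -- Along a path with m₁ left, m₂ center and m₃ right edges, m₂ + 2 m₃ sibling subtrees hang to
  -- the left of the path and 2 m₁ + m₂ to its right.
  pathFlank : ℕ → ℕ → ℕ → ℕ → ℕ → ℕ → ℕ → ℕ
  pathFlank kL kR n s m₁ m₂ m₃ = flankCount (kL + (m₂ + 2 * m₃)) (kR + (2 * m₁ + m₂)) (n ∸ (m₁ + m₂ + m₃)) s

  private
    flankCount-cong : ∀ {kL kL′ kR kR′ n n′} s → kL ≡ kL′ → kR ≡ kR′ → n ≡ n′ →
      flankCount kL kR n s ≡ flankCount kL′ kR′ n′ s
    flankCount-cong s refl refl refl = refl

  pathFlank-left : ∀ kL kR n s k m₂ m₃ → pathFlank kL (2 + kR) n s k m₂ m₃ ≡ pathFlank kL kR (suc n) s (suc k) m₂ m₃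
  pathFlank-left kL kR n s k m₂ m₃ = cong (λ k′ → flankCount (kL + (m₂ + 2 * m₃)) k′ (n ∸ (k + m₂ + m₃)) s) (shift kR k m₂)
    where
    shift : ∀ kR k m₂ → 2 + kR + (2 * k + m₂) ≡ kR + (2 * suc k + m₂)
    shift = solve-∀

  pathFlank-center : ∀ kL kR n s m₁ k m₃ → pathFlank (suc kL) (suc kR) n s m₁ k m₃ ≡ pathFlank kL kR (suc n) s m₁ (suc k) m₃
  pathFlank-center kL kR n s m₁ k m₃ =
    flankCount-cong s (shiftL kL k m₃) (shiftR kR m₁ k) (cong (suc n ∸_) (sym (cong (_+ m₃) (+-suc m₁ k))))
    where
    shiftL : ∀ kL k m₃ → suc kL + (k + 2 * m₃) ≡ kL + (suc k + 2 * m₃)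
    shiftL = solve-∀
    shiftR : ∀ kR m₁ k → suc kR + (2 * m₁ + k) ≡ kR + (2 * m₁ + suc k)
    shiftR = solve-∀

  pathFlank-right : ∀ kL kR n s m₁ m₂ k → pathFlank (2 + kL) kR n s m₁ m₂ k ≡ pathFlank kL kR (suc n) s m₁ m₂ (suc k)
  pathFlank-right kL kR n s m₁ m₂ k =
    cong₂ (λ k′ n′ → flankCount k′ (kR + (2 * m₁ + m₂)) n′ s) (shift kL m₂ k) (cong (suc n ∸_) (sym (+-suc (m₁ + m₂) k)))
    where
    shift : ∀ kL m₂ k → 2 + kL + (m₂ + 2 * k) ≡ kL + (m₂ + 2 * suc k)
    shift = solve-∀

  mutual
    contextCount≡trinom : ∀ n → n ≤ N → ∀ kL kR s m₁ m₂ m₃ → m₁ + m₂ + m₃ ≤ n →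
      contextCount kL kR n s m₁ m₂ m₃ ≡ trinom m₁ m₂ m₃ * pathFlank kL kR n s m₁ m₂ m₃
    contextCount≡trinom n n≤N kL kR s zero zero zero _ =
      trans (contextCount-nil kL kR n s n≤N)
            (trans (cong₂ (λ k k′ → flankCount k k′ n s) (sym (+-identityʳ kL)) (sym (+-identityʳ kR))) (sym (*-identityˡ _)))
    contextCount≡trinom n n≤N kL kR s (suc k) m₂       m₃       M≤n = contextCount≡trinom⁺ n n≤N kL kR s (suc k) m₂ m₃ (s≤s z≤n) M≤n
    contextCount≡trinom n n≤N kL kR s zero    (suc k) m₃       M≤n = contextCount≡trinom⁺ n n≤N kL kR s zero (suc k) m₃ (s≤s z≤n) M≤n
    contextCount≡trinom n n≤N kL kR s zero    zero    (suc k) M≤n = contextCount≡trinom⁺ n n≤N kL kR s zero zero (suc k) (s≤s z≤n) M≤n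

    contextCount≡trinom⁺ : ∀ n → n ≤ N → ∀ kL kR s m₁ m₂ m₃ → 1 ≤ m₁ + m₂ + m₃ → m₁ + m₂ + m₃ ≤ n →
      contextCount kL kR n s m₁ m₂ m₃ ≡ trinom m₁ m₂ m₃ * pathFlank kL kR n s m₁ m₂ m₃
    contextCount≡trinom⁺ zero    _   kL kR s m₁ m₂ m₃ 1≤M M≤0 = contradiction (≤-trans 1≤M M≤0) λ ()
    contextCount≡trinom⁺ (suc n) n<N kL kR s m₁ m₂ m₃ 1≤M M≤n = begin
      contextCount kL kR (suc n) s m₁ m₂ m₃
        ≡⟨ contextCount-suc kL kR n s m₁ m₂ m₃ n<N ⟩
      hasCounts m₁ m₂ m₃ [] * flankCount kL kR (suc n) s + (T₁ + T₂ + T₃)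
        ≡⟨ cong (λ h → h * flankCount kL kR (suc n) s + (T₁ + T₂ + T₃)) (hasCounts-[] m₁ m₂ m₃ 1≤M) ⟩
      T₁ + T₂ + T₃
        ≡⟨ cong₂ _+_ (cong₂ _+_ (left m₁ M≤n) (center m₂ M≤n)) (right m₃ M≤n) ⟩
      atPred m₁ (λ k → trinom k m₂ m₃ * F) + atPred m₂ (λ k → trinom m₁ k m₃ * F) + atPred m₃ (λ k → trinom m₁ m₂ k * F)
        ≡⟨ sym (cong₂ _+_ (cong₂ _+_ (atPred-*ʳ m₁ _ F) (atPred-*ʳ m₂ _ F)) (atPred-*ʳ m₃ _ F)) ⟩
      atPred m₁ (λ k → trinom k m₂ m₃) * F + atPred m₂ (λ k → trinom m₁ k m₃) * F + atPred m₃ (trinom m₁ m₂) * F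
        ≡⟨ sym (+-*-distrib³ (atPred m₁ (λ k → trinom k m₂ m₃)) (atPred m₂ (λ k → trinom m₁ k m₃)) (atPred m₃ (trinom m₁ m₂)) F) ⟩
      (atPred m₁ (λ k → trinom k m₂ m₃) + atPred m₂ (λ k → trinom m₁ k m₃) + atPred m₃ (trinom m₁ m₂)) * F
        ≡⟨ cong (_* F) (sym (trinom-pascal m₁ m₂ m₃ 1≤M)) ⟩
      trinom m₁ m₂ m₃ * F ∎
      where
      open ≡-Reasoning
      n≤N = ≤-trans (n≤1+n n) n<N
      F = pathFlank kL kR (suc n) s m₁ m₂ m₃
      T₁ = atPred m₁ (λ k → contextCount kL (2 + kR) n s k m₂ m₃)
      T₂ = atPred m₂ (λ k → contextCount (suc kL) (suc kR) n s m₁ k m₃)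
      T₃ = atPred m₃ (λ k → contextCount (2 + kL) kR n s m₁ m₂ k)
      +-*-distrib³ : ∀ x y z e → (x + y + z) * e ≡ x * e + y * e + z * e
      +-*-distrib³ = solve-∀
      left : ∀ m₁ → m₁ + m₂ + m₃ ≤ suc n →
        atPred m₁ (λ k → contextCount kL (2 + kR) n s k m₂ m₃) ≡ atPred m₁ (λ k → trinom k m₂ m₃ * pathFlank kL kR (suc n) s m₁ m₂ m₃)
      left zero    _         = refl
      left (suc k) (s≤s M≤n) =
        trans (contextCount≡trinom n n≤N kL (2 + kR) s k m₂ m₃ M≤n) (cong (trinom k m₂ m₃ *_) (pathFlank-left kL kR n s k m₂ m₃))
      center : ∀ m₂ → m₁ + m₂ + m₃ ≤ suc n →
        atPred m₂ (λ k → contextCount (suc kL) (suc kR) n s m₁ k m₃) ≡ atPred m₂ (λ k → trinom m₁ k m₃ * pathFlank kL kR (suc n) s m₁ m₂ m₃)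
      center zero    _   = refl
      center (suc k) M≤n =
        trans (contextCount≡trinom n n≤N (suc kL) (suc kR) s m₁ k m₃ (≤-pred (subst (_≤ suc n) (cong (_+ m₃) (+-suc m₁ k)) M≤n)))
              (cong (trinom m₁ k m₃ *_) (pathFlank-center kL kR n s m₁ k m₃))
      right : ∀ m₃ → m₁ + m₂ + m₃ ≤ suc n →
        atPred m₃ (λ k → contextCount (2 + kL) kR n s m₁ m₂ k) ≡ atPred m₃ (λ k → trinom m₁ m₂ k * pathFlank kL kR (suc n) s m₁ m₂ m₃)
      right zero    _   = refl
      right (suc k) M≤n =
        trans (contextCount≡trinom n n≤N (2 + kL) kR s m₁ m₂ k (≤-pred (subst (_≤ suc n) (+-suc (m₁ + m₂) k) M≤n)))
              (cong (trinom m₁ m₂ k *_) (pathFlank-right kL kR n s m₁ m₂ k))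

Tcount≡contextCount : ∀ n s m₁ m₂ m₃ → Tcount n s m₁ m₂ m₃ ≡ Decomposition.contextCount n 0 0 n s m₁ m₂ m₃
Tcount≡contextCount n s m₁ m₂ m₃ =
  trans (length-filterᵇ-filterᵇ (pathHas s m₁ m₂ m₃) (λ t → size t ≡ᵇ n) (treesOfHeight≤ n))
        (sumBy-cong (λ t → cong₂ _*_ (cong (λ x → δ x n) (sym (+-identityʳ (size t)))) (𝟙-pathHas≡pathCount s m₁ m₂ m₃ t))
                    (treesOfHeight≤ n))

Tcount-hit : ∀ n s m₁ m₂ m₃ a b → m₁ + m₂ + m₃ + a + b ≡ n → s ≡ 2 * a + (m₂ + 2 * m₃) →
  Tcount n s m₁ m₂ m₃ ≡ trinom m₁ m₂ m₃ * (forests (m₂ + 2 * m₃) a * forests (2 * m₁ + m₂) b)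
Tcount-hit n s m₁ m₂ m₃ a b M+a+b≡n s≡ = begin
  Tcount n s m₁ m₂ m₃                                    ≡⟨ Tcount≡contextCount n s m₁ m₂ m₃ ⟩
  contextCount 0 0 n s m₁ m₂ m₃                          ≡⟨ contextCount≡trinom n ≤-refl 0 0 s m₁ m₂ m₃ M≤n ⟩
  trinom m₁ m₂ m₃ * flankCount kL kR (n ∸ M) s          ≡⟨ cong (λ x → trinom m₁ m₂ m₃ * flankCount kL kR x s) n∸M≡a+b ⟩
  trinom m₁ m₂ m₃ * flankCount kL kR (a + b) s          ≡⟨ cong (λ x → trinom m₁ m₂ m₃ * flankCount kL kR (a + b) x) s≡ ⟩
  trinom m₁ m₂ m₃ * flankCount kL kR (a + b) (2 * a + kL)
    ≡⟨ cong (trinom m₁ m₂ m₃ *_) (flankCount-hit kL kR (a + b) a (m≤m+n a b)) ⟩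
  trinom m₁ m₂ m₃ * (forestCount kL a * forestCount kR (a + b ∸ a))
    ≡⟨ cong (λ x → trinom m₁ m₂ m₃ * (forestCount kL a * forestCount kR x)) (m+n∸m≡n a b) ⟩
  trinom m₁ m₂ m₃ * (forestCount kL a * forestCount kR b)
    ≡⟨ cong₂ (λ u v → trinom m₁ m₂ m₃ * (u * v)) (forestCount≡forests kL a a≤n) (forestCount≡forests kR b b≤n) ⟩
  trinom m₁ m₂ m₃ * (forests kL a * forests kR b) ∎
  where
  open ≡-Reasoning
  open Decomposition n
  M = m₁ + m₂ + m₃
  kL = m₂ + 2 * m₃
  kR = 2 * m₁ + m₂
  M+[a+b]≡n : M + (a + b) ≡ n
  M+[a+b]≡n = trans (sym (+-assoc M a b)) M+a+b≡n
  M≤n : M ≤ n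
  M≤n = subst (M ≤_) M+[a+b]≡n (m≤m+n M (a + b))
  n∸M≡a+b : n ∸ M ≡ a + b
  n∸M≡a+b = trans (cong (_∸ M) (sym M+[a+b]≡n)) (m+n∸m≡n M (a + b))
  a≤n : a ≤ n
  a≤n = subst (a ≤_) M+[a+b]≡n (≤-trans (m≤m+n a b) (m≤n+m (a + b) M))
  b≤n : b ≤ n
  b≤n = subst (b ≤_) M+[a+b]≡n (≤-trans (m≤n+m b a) (m≤n+m (a + b) M))

Tcount-miss : ∀ n s m₁ m₂ m₃ → (∀ a b → m₁ + m₂ + m₃ + a + b ≡ n → s ≢ 2 * a + (m₂ + 2 * m₃)) →
  Tcount n s m₁ m₂ m₃ ≡ 0
Tcount-miss n s m₁ m₂ m₃ miss with m₁ + m₂ + m₃ ≤? n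
... | no  M≰n = trans (Tcount≡contextCount n s m₁ m₂ m₃) (contextCount-vanishes n ≤-refl 0 0 s m₁ m₂ m₃ (≰⇒> M≰n))
  where open Decomposition n
... | yes M≤n = trans (Tcount≡contextCount n s m₁ m₂ m₃) (trans (contextCount≡trinom n ≤-refl 0 0 s m₁ m₂ m₃ M≤n)
    (trans (cong (trinom m₁ m₂ m₃ *_) (flankCount-miss (m₂ + 2 * m₃) (2 * m₁ + m₂) (n ∸ M) s miss′)) (*-zeroʳ (trinom m₁ m₂ m₃))))
  where
  open Decomposition n
  M = m₁ + m₂ + m₃
  miss′ : ∀ a → a ≤ n ∸ M → s ≢ 2 * a + (m₂ + 2 * m₃)
  miss′ a a≤ = miss a (n ∸ M ∸ a) (trans (+-assoc M a _) (trans (cong (M +_) (m+[n∸m]≡n a≤)) (m+[n∸m]≡n M≤n)))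

-- The four cases

forests-ballot² : ∀ t kL kR a b →
  t * (forests kL a * forests kR b) * (3 * a + kL) * (3 * b + kR)
    ≡ kL * kR * t * ((3 * a + kL) C a) * ((3 * b + kR) C b)
forests-ballot² t kL kR a b = begin
  t * (forests kL a * forests kR b) * (3 * a + kL) * (3 * b + kR)
    ≡⟨ pair-up t (forests kL a) (forests kR b) (3 * a + kL) (3 * b + kR) ⟩
  t * (((3 * a + kL) * forests kL a) * ((3 * b + kR) * forests kR b))
    ≡⟨ cong₂ (λ u v → t * (u * v)) (forests-ballot kL a) (forests-ballot kR b) ⟩
  t * ((kL * binom (3 * a + kL) a) * (kR * binom (3 * b + kR) b))
    ≡⟨ cong₂ (λ u v → t * ((kL * u) * (kR * v))) (binom≡C _ a) (binom≡C _ b) ⟩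
  t * ((kL * ((3 * a + kL) C a)) * (kR * ((3 * b + kR) C b)))
    ≡⟨ pull-out t kL kR ((3 * a + kL) C a) ((3 * b + kR) C b) ⟩
  kL * kR * t * ((3 * a + kL) C a) * ((3 * b + kR) C b) ∎
  where
  open ≡-Reasoning
  pair-up : ∀ t f g x y → t * (f * g) * x * y ≡ t * ((x * f) * (y * g))
  pair-up = solve-∀
  pull-out : ∀ t k k′ c c′ → t * ((k * c) * (k′ * c′)) ≡ k * k′ * t * c * c′
  pull-out = solve-∀

halve : ∀ m → m ≡ m % 2 + 2 * (m / 2)
halve m = trans (m≡m%n+[m/n]*n m 2) (cong (m % 2 +_) (*-comm (m / 2) 2))

m%2≤1 : ∀ m → m % 2 ≤ 1
m%2≤1 m = ≤-pred (m%n<n m 2)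

<-by-parity : ∀ a b c d → b ≤ 1 → a < c → 2 * a + b < 2 * c + d
<-by-parity a b c d b≤1 a<c =
  ≤-trans (s≤s (+-monoʳ-≤ (2 * a) b≤1)) (≤-trans (≤-reflexive (double a)) (≤-trans (*-monoʳ-≤ 2 a<c) (m≤m+n (2 * c) d)))
  where
  double : ∀ a → suc (2 * a + 1) ≡ 2 * suc a
  double = solve-∀

parity-injective : ∀ a b c d → b ≤ 1 → d ≤ 1 → 2 * a + b ≡ 2 * c + d → a ≡ c × b ≡ d
parity-injective a b c d b≤1 d≤1 eq with <-cmp a c
... | tri< a<c _ _ = contradiction eq (<⇒≢ (<-by-parity a b c d b≤1 a<c))
... | tri> _ _ c<a = contradiction (sym eq) (<⇒≢ (<-by-parity c d a b d≤1 c<a))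
... | tri≈ _ refl _ = refl , +-cancelˡ-≡ (2 * a) b d eq

position : ∀ s₁ s₂ m₂ m₃ r μ a → s₂ ≤ 1 → r ≤ 1 → m₂ ≡ r + 2 * μ →
  2 * s₁ + s₂ ≡ 2 * a + (m₂ + 2 * m₃) → s₁ ≡ a + (m₃ + μ) × s₂ ≡ r
position s₁ s₂ _ m₃ r μ a s₂≤1 r≤1 refl eq = parity-injective s₁ s₂ (a + (m₃ + μ)) r s₂≤1 r≤1 (trans eq (regroup a m₃ μ r))
  where
  regroup : ∀ a m₃ μ r → 2 * a + ((r + 2 * μ) + 2 * m₃) ≡ 2 * (a + (m₃ + μ)) + r
  regroup = solve-∀

position⁻¹ : ∀ s₁ s₂ m₂ m₃ μ a → s₁ ≡ a + (m₃ + μ) → m₂ ≡ s₂ + 2 * μ → 2 * s₁ + s₂ ≡ 2 * a + (m₂ + 2 * m₃)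
position⁻¹ _ s₂ _ m₃ μ a refl refl = regroup a m₃ μ s₂
  where
  regroup : ∀ a m₃ μ s₂ → 2 * (a + (m₃ + μ)) + s₂ ≡ 2 * a + ((s₂ + 2 * μ) + 2 * m₃)
  regroup = solve-∀

open import Data.Integer as ℤ using (+_; -[1+_])
import Data.Integer.Properties as ℤ

[+m]-[+n]≡+k : ∀ {m n k} → m ≡ k + n → + m ℤ.- + n ≡ + k
[+m]-[+n]≡+k {n = n} {k} refl =
  trans (ℤ.[+m]-[+n]≡m⊖n (k + n) n) (trans (ℤ.⊖-≥ (m≤n+m n k)) (cong +_ (m+n∸n≡m k n)))

binomℤ-negative : ∀ D {a b} → a < b → binomℤ D (+ a ℤ.- + b) ≡ 0
binomℤ-negative D {a} {b} a<b =
  trans (cong (binomℤ D) (trans (ℤ.[+m]-[+n]≡m⊖n a b) (ℤ.⊖-< a<b))) (negative D (m<n⇒0<n∸m a<b))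
  where
  negative : ∀ D {x} → 0 < x → binomℤ D (ℤ.- (+ x)) ≡ 0
  negative (+ _)    {suc _} _ = refl
  negative -[1+ _ ] {suc _} _ = refl

caseI-hit : ∀ n s₁ s₂ m₁ m₂ m₃ μ a b → m₂ ≡ s₂ + 2 * μ → s₁ ≡ a + (m₃ + μ) → m₁ + m₂ + m₃ + a + b ≡ n →
  (+ Tcount n (2 * s₁ + s₂) m₁ m₂ m₃) ℤ.* D₁ n s₁ s₂ m₁ m₂ m₃ μ ℤ.* D₂ n s₁ s₂ m₁ m₂ m₃ μ ≡ + NumI n s₁ s₂ m₁ m₂ m₃ μ
caseI-hit _ _ s₂ m₁ _ m₃ μ a b refl refl refl = begin
  + T ℤ.* D₁ n s₁ s₂ m₁ m₂ m₃ μ ℤ.* D₂ n s₁ s₂ m₁ m₂ m₃ μ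
    ≡⟨ cong₂ (λ u v → + T ℤ.* u ℤ.* v) d₁ d₂ ⟩
  + T ℤ.* + X ℤ.* + Y
    ≡⟨ trans (cong (ℤ._* + Y) (sym (ℤ.pos-* T X))) (sym (ℤ.pos-* (T * X) Y)) ⟩
  + (T * X * Y)
    ≡⟨ cong (λ t → + (t * X * Y)) (Tcount-hit n s m₁ m₂ m₃ a b refl (position⁻¹ s₁ s₂ m₂ m₃ μ a refl refl)) ⟩
  + (trinom m₁ m₂ m₃ * (forests kL a * forests kR b) * X * Y)
    ≡⟨ cong +_ (forests-ballot² (trinom m₁ m₂ m₃) kL kR a b) ⟩
  + (kL * kR * trinom m₁ m₂ m₃ * (X C a) * (Y C b))
    ≡⟨ cong₂ (λ u v → + (u * kR * v * (X C a) * (Y C b))) (+-comm m₂ (2 * m₃)) (trinom≡multinomial3 m₁ m₂ m₃) ⟩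
  + ((2 * m₃ + m₂) * kR * multinomial3 m₁ m₂ m₃ * (X C a) * (Y C b))
    ≡⟨ cong₂ (λ u v → + ((2 * m₃ + m₂) * kR * multinomial3 m₁ m₂ m₃ * u * v))
             (sym (cong₂ binomℤ d₁ b₁)) (sym (cong₂ binomℤ d₂ b₂)) ⟩
  + NumI n s₁ s₂ m₁ m₂ m₃ μ ∎
  where
  open ≡-Reasoning
  m₂ = s₂ + 2 * μ
  s₁ = a + (m₃ + μ)
  n = m₁ + m₂ + m₃ + a + b
  s = 2 * s₁ + s₂
  T = Tcount n s m₁ m₂ m₃
  kL = m₂ + 2 * m₃
  kR = 2 * m₁ + m₂
  X = 3 * a + kL
  Y = 3 * b + kR
  d₁ : D₁ n s₁ s₂ m₁ m₂ m₃ μ ≡ + X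
  d₁ = [+m]-[+n]≡+k (regroup a μ m₃ s₂)
    where regroup : ∀ a μ m₃ s₂ → 3 * (a + (m₃ + μ)) + s₂ ≡ (3 * a + ((s₂ + 2 * μ) + 2 * m₃)) + (m₃ + μ)
          regroup = solve-∀
  b₁ : bot₁ n s₁ s₂ m₁ m₂ m₃ μ ≡ + a
  b₁ = [+m]-[+n]≡+k {n = m₃ + μ} refl
  d₂ : D₂ n s₁ s₂ m₁ m₂ m₃ μ ≡ + Y
  d₂ = [+m]-[+n]≡+k (regroup a b μ m₁ m₃ s₂)
    where regroup : ∀ a b μ m₁ m₃ s₂ → 3 * (m₁ + (s₂ + 2 * μ) + m₃ + a + b) + 3 * μ
                    ≡ (3 * b + (2 * m₁ + (s₂ + 2 * μ))) + (m₁ + 2 * (s₂ + 2 * μ) + 3 * (a + (m₃ + μ)))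
          regroup = solve-∀
  b₂ : bot₂ n s₁ s₂ m₁ m₂ m₃ μ ≡ + b
  b₂ = [+m]-[+n]≡+k (regroup a b μ m₁ m₃ s₂)
    where regroup : ∀ a b μ m₁ m₃ s₂ → m₁ + (s₂ + 2 * μ) + m₃ + a + b + μ ≡ b + (m₁ + (s₂ + 2 * μ) + (a + (m₃ + μ)))
          regroup = solve-∀

caseI-miss : ∀ n s₁ s₂ m₁ m₂ m₃ μ → Tcount n (2 * s₁ + s₂) m₁ m₂ m₃ ≡ 0 → n + μ < m₁ + m₂ + s₁ →
  (+ Tcount n (2 * s₁ + s₂) m₁ m₂ m₃) ℤ.* D₁ n s₁ s₂ m₁ m₂ m₃ μ ℤ.* D₂ n s₁ s₂ m₁ m₂ m₃ μ ≡ + NumI n s₁ s₂ m₁ m₂ m₃ μ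
caseI-miss n s₁ s₂ m₁ m₂ m₃ μ T≡0 n+μ< =
  trans (cong (λ t → + t ℤ.* D₁ n s₁ s₂ m₁ m₂ m₃ μ ℤ.* D₂ n s₁ s₂ m₁ m₂ m₃ μ) T≡0)
        (cong +_ (sym (trans (cong (prefix *_) (binomℤ-negative (D₂ n s₁ s₂ m₁ m₂ m₃ μ) n+μ<)) (*-zeroʳ prefix))))
  where
  prefix = (2 * m₃ + m₂) * (2 * m₁ + m₂) * multinomial3 m₁ m₂ m₃ * binomℤ (D₁ n s₁ s₂ m₁ m₂ m₃ μ) (bot₁ n s₁ s₂ m₁ m₂ m₃ μ)

Tcount-miss-at : ∀ n s₁ s₂ m₁ m₂ m₃ μ a → s₂ ≤ 1 → m₂ ≡ s₂ + 2 * μ → s₁ ≡ a + (m₃ + μ) →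
  ¬ (m₁ + m₂ + m₃ + a ≤ n) → Tcount n (2 * s₁ + s₂) m₁ m₂ m₃ ≡ 0
Tcount-miss-at n s₁ s₂ m₁ m₂ m₃ μ a s₂≤1 m₂≡ s₁≡ M+a≰n = Tcount-miss n _ m₁ m₂ m₃ λ a′ b′ n≡ s≡ →
  M+a≰n (subst (λ x → m₁ + m₂ + m₃ + x ≤ n) (a′≡a a′ s≡) (subst (m₁ + m₂ + m₃ + a′ ≤_) n≡ (m≤m+n _ b′)))
  where
  a′≡a : ∀ a′ → 2 * s₁ + s₂ ≡ 2 * a′ + (m₂ + 2 * m₃) → a′ ≡ a
  a′≡a a′ s≡ = +-cancelʳ-≡ (m₃ + μ) a′ a (trans (sym (proj₁ (position s₁ s₂ m₂ m₃ s₂ μ a′ s₂≤1 s₂≤1 m₂≡ s≡))) s₁≡)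

caseI-at : ∀ n s₁ s₂ m₁ m₂ m₃ μ a → s₂ ≤ 1 → m₂ ≡ s₂ + 2 * μ → s₁ ≡ a + (m₃ + μ) →
  (+ Tcount n (2 * s₁ + s₂) m₁ m₂ m₃) ℤ.* D₁ n s₁ s₂ m₁ m₂ m₃ μ ℤ.* D₂ n s₁ s₂ m₁ m₂ m₃ μ ≡ + NumI n s₁ s₂ m₁ m₂ m₃ μ
caseI-at n s₁ s₂ m₁ m₂ m₃ μ a s₂≤1 m₂≡ s₁≡ with m₁ + m₂ + m₃ + a ≤? n
... | yes M+a≤n = caseI-hit n s₁ s₂ m₁ m₂ m₃ μ a (n ∸ (m₁ + m₂ + m₃ + a)) m₂≡ s₁≡ (m+[n∸m]≡n M+a≤n)
... | no M+a≰n = caseI-miss n s₁ s₂ m₁ m₂ m₃ μ (Tcount-miss-at n s₁ s₂ m₁ m₂ m₃ μ a s₂≤1 m₂≡ s₁≡ M+a≰n) n+μ<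
  where
  n+μ< : n + μ < m₁ + m₂ + s₁
  n+μ< = subst (n + μ <_) (trans (regroup m₁ m₂ m₃ a μ) (cong (λ x → m₁ + m₂ + x) (sym s₁≡))) (+-monoˡ-< μ (≰⇒> M+a≰n))
    where
    regroup : ∀ m₁ m₂ m₃ a μ → m₁ + m₂ + m₃ + a + μ ≡ m₁ + m₂ + (a + (m₃ + μ))
    regroup = solve-∀

caseI : ∀ n s₁ s₂ m₁ m₂ m₃ μ → s₂ ≤ 1 → CaseI s₁ s₂ m₁ m₂ m₃ μ →
  (+ Tcount n (2 * s₁ + s₂) m₁ m₂ m₃) ℤ.* D₁ n s₁ s₂ m₁ m₂ m₃ μ ℤ.* D₂ n s₁ s₂ m₁ m₂ m₃ μ ≡ + NumI n s₁ s₂ m₁ m₂ m₃ μ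
caseI n s₁ s₂ m₁ m₂ m₃ μ s₂≤1 (m₃≤s₁ , m₂≡ , μ≤s₁∸m₃ , _ , _) =
  caseI-at n s₁ s₂ m₁ m₂ m₃ μ (s₁ ∸ (m₃ + μ)) s₂≤1 m₂≡
    (sym (m∸n+n≡m (≤-trans (+-monoʳ-≤ m₃ μ≤s₁∸m₃) (≤-reflexive (m+[n∸m]≡n m₃≤s₁)))))

forests-ballot-2m : ∀ m n → m ≤ n → forests (2 * m) (n ∸ m) * (3 * n ∸ m) ≡ 2 * m * ((3 * n ∸ m) C (2 * n))
forests-ballot-2m m n m≤n = subst (λ x → forests (2 * m) (x ∸ m) * (3 * x ∸ m) ≡ 2 * m * ((3 * x ∸ m) C (2 * x)))
  (m+[n∸m]≡n m≤n) (trans (cong (λ b → forests (2 * m) b * (3 * (m + (n ∸ m)) ∸ m)) (m+n∸m≡n m (n ∸ m))) (at (n ∸ m)))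
  where
  open ≡-Reasoning
  at : ∀ b → forests (2 * m) b * (3 * (m + b) ∸ m) ≡ 2 * m * ((3 * (m + b) ∸ m) C (2 * (m + b)))
  at b = begin
    forests (2 * m) b * (3 * (m + b) ∸ m)              ≡⟨ cong (forests (2 * m) b *_) 3[m+b]∸m ⟩
    forests (2 * m) b * (3 * b + 2 * m)                 ≡⟨ *-comm _ (3 * b + 2 * m) ⟩
    (3 * b + 2 * m) * forests (2 * m) b                 ≡⟨ forests-ballot (2 * m) b ⟩
    2 * m * binom (3 * b + 2 * m) b                     ≡⟨ cong (2 * m *_) (binom≡C _ b) ⟩
    2 * m * ((3 * b + 2 * m) C b)                       ≡⟨ cong (2 * m *_) (nCk≡nC[n∸k] (≤-trans (m≤n*m b 3) (m≤m+n (3 * b) (2 * m)))) ⟩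
    2 * m * ((3 * b + 2 * m) C (3 * b + 2 * m ∸ b))     ≡⟨ cong₂ (λ u v → 2 * m * (u C v)) (sym 3[m+b]∸m) complement ⟩
    2 * m * ((3 * (m + b) ∸ m) C (2 * (m + b)))         ∎
    where
    3[m+b]∸m : 3 * (m + b) ∸ m ≡ 3 * b + 2 * m
    3[m+b]∸m = trans (cong (_∸ m) (expand m b)) (m+n∸m≡n m _)
      where expand : ∀ m b → 3 * (m + b) ≡ m + (3 * b + 2 * m)
            expand = solve-∀
    complement : 3 * b + 2 * m ∸ b ≡ 2 * (m + b)
    complement = trans (cong (_∸ b) (expand m b)) (m+n∸m≡n b _)
      where expand : ∀ m b → 3 * b + 2 * m ≡ b + 2 * (m + b)
            expand = solve-∀

caseII : ∀ n s m₁ m₂ m₃ → CaseII n s m₁ m₂ m₃ →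
  Tcount n s m₁ m₂ m₃ * (3 * n ∸ m₁) ≡ 2 * m₁ * ((3 * n ∸ m₁) C (2 * n))
caseII n s m₁ _ _ (refl , refl , s≡0 , m₁≤n) = trans (cong (_* (3 * n ∸ m₁)) T≡) (forests-ballot-2m m₁ n m₁≤n)
  where
  T≡ : Tcount n s m₁ 0 0 ≡ forests (2 * m₁) (n ∸ m₁)
  T≡ = trans (Tcount-hit n s m₁ 0 0 0 (n ∸ m₁) (trans (cong (_+ (n ∸ m₁)) (+-identityʳ³ m₁)) (m+[n∸m]≡n m₁≤n)) s≡0)
         (trans (cong₂ (λ t k → t * (1 * forests k (n ∸ m₁))) (trans (*-identityʳ _) (binom₂-b-0 m₁)) (+-identityʳ (2 * m₁)))
                (trans (*-identityˡ _) (*-identityˡ _)))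
    where
    +-identityʳ³ : ∀ m → m + 0 + 0 + 0 ≡ m
    +-identityʳ³ = solve-∀

caseIII : ∀ n s m₁ m₂ m₃ → CaseIII n s m₁ m₂ m₃ →
  Tcount n s m₁ m₂ m₃ * (3 * n ∸ m₃) ≡ 2 * m₃ * ((3 * n ∸ m₃) C (2 * n))
caseIII n s _ _ m₃ (refl , refl , s≡2n , m₃≤n) = trans (cong (_* (3 * n ∸ m₃)) T≡) (forests-ballot-2m m₃ n m₃≤n)
  where
  a = n ∸ m₃
  m₃+a≡n : m₃ + a ≡ n
  m₃+a≡n = m+[n∸m]≡n m₃≤n
  T≡ : Tcount n s 0 0 m₃ ≡ forests (2 * m₃) a
  T≡ = trans (Tcount-hit n s 0 0 m₃ a 0 (trans (+-identityʳ (m₃ + a)) m₃+a≡n)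
                         (trans s≡2n (trans (cong (2 *_) (sym m₃+a≡n)) (regroup m₃ a))))
             (trans (*-identityˡ _) (*-identityʳ _))
    where
    regroup : ∀ m₃ a → 2 * (m₃ + a) ≡ 2 * a + (0 + 2 * m₃)
    regroup = solve-∀

Tcount-zero-or-hit : ∀ n s₁ s₂ m₁ m₂ m₃ → s₂ ≤ 1 →
  Tcount n (2 * s₁ + s₂) m₁ m₂ m₃ ≡ 0
  ⊎ ∃ λ μ → ∃ λ a → ∃ λ b → m₂ ≡ s₂ + 2 * μ × s₁ ≡ a + (m₃ + μ) × m₁ + m₂ + m₃ + a + b ≡ n
Tcount-zero-or-hit n s₁ s₂ m₁ m₂ m₃ s₂≤1 with s₂ ≟ m₂ % 2 | m₃ + m₂ / 2 ≤? s₁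
... | no s₂≢r | _ = inj₁ (Tcount-miss n _ m₁ m₂ m₃ λ a _ _ s≡ →
  s₂≢r (proj₂ (position s₁ s₂ m₂ m₃ _ (m₂ / 2) a s₂≤1 (m%2≤1 m₂) (halve m₂) s≡)))
... | yes refl | no m₃+μ≰s₁ = inj₁ (Tcount-miss n _ m₁ m₂ m₃ λ a _ _ s≡ →
  m₃+μ≰s₁ (subst (m₃ + m₂ / 2 ≤_) (sym (proj₁ (position s₁ _ m₂ m₃ _ (m₂ / 2) a s₂≤1 s₂≤1 (halve m₂) s≡))) (m≤n+m _ a)))
... | yes refl | yes m₃+μ≤s₁ with m₁ + m₂ + m₃ + (s₁ ∸ (m₃ + m₂ / 2)) ≤? n
...   | no  M+a≰n = inj₁ (Tcount-miss-at n s₁ _ m₁ m₂ m₃ (m₂ / 2) _ s₂≤1 (halve m₂) (sym (m∸n+n≡m m₃+μ≤s₁)) M+a≰n)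
...   | yes M+a≤n = inj₂ (m₂ / 2 , _ , _ , halve m₂ , sym (m∸n+n≡m m₃+μ≤s₁) , m+[n∸m]≡n M+a≤n)

caseI-shape : ∀ s₁ m₃ μ a → s₁ ≡ a + (m₃ + μ) → m₃ ≤ s₁ × μ ≤ s₁ ∸ m₃
caseI-shape _ m₃ μ a refl =
  ≤-trans (m≤m+n m₃ μ) (m≤n+m _ a) ,
  subst (μ ≤_) (sym (trans (cong (_∸ m₃) (regroup a m₃ μ)) (m+n∸m≡n m₃ (a + μ)))) (m≤n+m μ a)
  where
  regroup : ∀ a m₃ μ → a + (m₃ + μ) ≡ m₃ + (a + μ)
  regroup = solve-∀

caseIV-hit : ∀ n s₁ s₂ m₁ m₂ m₃ μ a b → m₂ ≡ s₂ + 2 * μ → s₁ ≡ a + (m₃ + μ) → m₁ + m₂ + m₃ + a + b ≡ n →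
  ¬ (∃ λ μ → CaseI s₁ s₂ m₁ m₂ m₃ μ) → ¬ CaseII n (2 * s₁ + s₂) m₁ m₂ m₃ → ¬ CaseIII n (2 * s₁ + s₂) m₁ m₂ m₃ →
  Tcount n (2 * s₁ + s₂) m₁ m₂ m₃ ≡ 0
caseIV-hit n s₁ s₂ m₁ m₂ m₃ μ a b m₂≡ s₁≡ n≡ ¬I ¬II ¬III with m₂ ≟ 0 | m₁ ≟ 0 | m₃ ≟ 0 | a ≟ 0 | b ≟ 0
... | no m₂≢0 | _       | _       | _    | _ =
  contradiction (μ , proj₁ shape , m₂≡ , proj₂ shape , m₂≢0 ∘ proj₂ , m₂≢0 ∘ proj₂) ¬I
  where shape = caseI-shape s₁ m₃ μ a s₁≡
... | yes _   | no m₁≢0 | no m₃≢0 | _    | _ =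
  contradiction (μ , proj₁ shape , m₂≡ , proj₂ shape , m₁≢0 ∘ proj₁ , m₃≢0 ∘ proj₁) ¬I
  where shape = caseI-shape s₁ m₃ μ a s₁≡
... | yes refl | yes refl | _ | _ | yes refl =
  contradiction (refl , refl , trans (position⁻¹ s₁ s₂ 0 m₃ μ a s₁≡ m₂≡) (trans (regroup m₃ a) (cong (2 *_) n≡)) ,
                 subst (m₃ ≤_) n≡ (subst (m₃ ≤_) (sym (+-identityʳ _)) (m≤m+n m₃ a))) ¬III
  where
  regroup : ∀ m₃ a → 2 * a + (0 + 2 * m₃) ≡ 2 * (0 + 0 + m₃ + a + 0)
  regroup = solve-∀
... | yes refl | yes refl | _ | _ | no b≢0 =
  trans (Tcount-hit n _ 0 0 m₃ a b n≡ (position⁻¹ s₁ s₂ 0 m₃ μ a s₁≡ m₂≡))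
        (trans (cong (λ x → trinom 0 0 m₃ * (forests (0 + 2 * m₃) a * x)) (forests-0-≢0 b b≢0))
               (vanish (trinom 0 0 m₃) (forests (0 + 2 * m₃) a)))
  where
  vanish : ∀ x y → x * (y * 0) ≡ 0
  vanish = solve-∀
... | yes refl | no _ | yes refl | yes refl | _ =
  contradiction (refl , refl , position⁻¹ s₁ s₂ 0 0 μ 0 s₁≡ m₂≡ , subst (m₁ ≤_) n≡ (subst (m₁ ≤_) (regroup m₁ b) (m≤m+n m₁ b))) ¬II
  where
  regroup : ∀ m₁ b → m₁ + b ≡ m₁ + 0 + 0 + 0 + b
  regroup = solve-∀
... | yes refl | no _ | yes refl | no a≢0 | _ =
  trans (Tcount-hit n _ m₁ 0 0 a b n≡ (position⁻¹ s₁ s₂ 0 0 μ a s₁≡ m₂≡))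
        (trans (cong (λ x → trinom m₁ 0 0 * (x * forests (2 * m₁ + 0) b)) (forests-0-≢0 a a≢0))
               (*-zeroʳ (trinom m₁ 0 0)))

caseIV : ∀ n s₁ s₂ m₁ m₂ m₃ → s₂ ≤ 1 →
  ¬ (∃ λ μ → CaseI s₁ s₂ m₁ m₂ m₃ μ) → ¬ CaseII n (2 * s₁ + s₂) m₁ m₂ m₃ → ¬ CaseIII n (2 * s₁ + s₂) m₁ m₂ m₃ →
  Tcount n (2 * s₁ + s₂) m₁ m₂ m₃ ≡ 0
caseIV n s₁ s₂ m₁ m₂ m₃ s₂≤1 ¬I ¬II ¬III with Tcount-zero-or-hit n s₁ s₂ m₁ m₂ m₃ s₂≤1
... | inj₁ T≡0 = T≡0
... | inj₂ (μ , a , b , m₂≡ , s₁≡ , n≡) = caseIV-hit n s₁ s₂ m₁ m₂ m₃ μ a b m₂≡ s₁≡ n≡ ¬I ¬II ¬III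

theorem4 : (n s₁ s₂ m₁ m₂ m₃ : ℕ) → 1 ≤ n → s₂ ≤ 1 → 2 * s₁ + s₂ ≤ 2 * n →
    ((μ₂ : ℕ) → CaseI s₁ s₂ m₁ m₂ m₃ μ₂ →
      (+ Tcount n (2 * s₁ + s₂) m₁ m₂ m₃) ℤ.* D₁ n s₁ s₂ m₁ m₂ m₃ μ₂ ℤ.* D₂ n s₁ s₂ m₁ m₂ m₃ μ₂
        ≡ + NumI n s₁ s₂ m₁ m₂ m₃ μ₂)
    × (CaseII n (2 * s₁ + s₂) m₁ m₂ m₃ →
      Tcount n (2 * s₁ + s₂) m₁ m₂ m₃ * (3 * n ∸ m₁) ≡ 2 * m₁ * ((3 * n ∸ m₁) C (2 * n)))
    × (CaseIII n (2 * s₁ + s₂) m₁ m₂ m₃ →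
      Tcount n (2 * s₁ + s₂) m₁ m₂ m₃ * (3 * n ∸ m₃) ≡ 2 * m₃ * ((3 * n ∸ m₃) C (2 * n)))
    × (¬ (∃ λ μ₂ → CaseI s₁ s₂ m₁ m₂ m₃ μ₂) → ¬ CaseII n (2 * s₁ + s₂) m₁ m₂ m₃ →
      ¬ CaseIII n (2 * s₁ + s₂) m₁ m₂ m₃ → Tcount n (2 * s₁ + s₂) m₁ m₂ m₃ ≡ 0)
theorem4 n s₁ s₂ m₁ m₂ m₃ _ s₂≤1 _ =
  (λ μ₂ → caseI n s₁ s₂ m₁ m₂ m₃ μ₂ s₂≤1) ,
  caseII n _ m₁ m₂ m₃ ,
  caseIII n _ m₁ m₂ m₃ ,
  caseIV n s₁ s₂ m₁ m₂ m₃ s₂≤1
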